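{- Let $q$ be odd, $\alpha\in\mathbb F_q\setminus\{0,1\}$, and let $$c_1(\alpha,q)=(q-1)^{ -1}(-1)^{a_2+a_3}\sum_{i=0}^{q-2}\chi_q(\alpha)^{a_3-i}J^{(a_1+i,\ a_2)}J^{(-i,\ a_3)}.$$ Suppose $a_3=a_2$, $2(a_1+a_2)\equiv0 \pmod{q-1}$ and $a_1+a_2\ne q-1$. If $\alpha^{\frac{q-1}{2}}=-1$ in $\mathbb F_q$, then $c_1(\alpha,q)=0$.
   Context: $q$ is a power of a prime $p$, $n\ge2$ with $n\mid q-1$; fix a prime $\mathfrak p'$ of $\mathbb Z[\epsilon_{q-1}]$ above $p$ with residue field $\mathbb F_q$; $\chi_q:\mathbb F_q^\times\to\mathbb Z[\epsilon_{q-1}]^\times$ is the Teichmüller character ($\chi_q(\lambda)\equiv\lambda$ mod $\mathfrak p'$, $\chi_q(\lambda)^{q-1}=1$), with $\chi_q^b(0)=0$ for all integers $b$. For integers $b,c$, $J^{(b,c)}=-\sum_{z_1,z_2\in\mathbb F_q,\ z_1+z_2+1=0}\chi_q^{b}(z_1)\chi_q^{c}(z_2)$. Here $a_i=n_i\frac{q-1}{n}$ with $0<n_i<n$ ($i=1,2,3$); $c_1(\alpha,q)$ is (as shown in the paper) the coefficient of $t$ in the $L$-series $L(\mathbb P^1_q,\chi_f,t)$ for $f=x^{n_1}(x-1)^{n_2}(x-\alpha)^{n_3}$. -}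

module Defs where

open import Level using (0ℓ)
open import Data.Nat as ℕ using (ℕ; zero; suc; NonZero)
open import Data.Integer as ℤ using (ℤ; _%ℕ_)
open import Data.List using (List; []; _∷_; length; map; upTo; foldr)
open import Data.List.Membership.Propositional using (_∈_)
open import Data.List.Relation.Unary.Unique.Propositional using (Unique)
open import Data.Product using (∃)
open import Data.Sum using (_⊎_)
open import Relation.Nullary using (yes; no)
open import Relation.Binary.Definitions using (DecidableEquality)
open import Relation.Binary.PropositionalEquality using (_≡_; _≢_)
open import Algebra.Core using (Op₁; Op₂)
import Algebra.Structures as AS

record FiniteField (q : ℕ) : Set₁ where
  infixl 6 _+_
  infixl 7 _*_
  field
    Carrier    : Set
    _+_ _*_    : Op₂ Carrier
    -_         : Op₁ Carrier
    0# 1#      : Carrier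
    isCommRing : AS.IsCommutativeRing _≡_ _+_ _*_ -_ 0# 1#
    _≟_        : DecidableEquality Carrier
    0≢1        : 0# ≢ 1#
    inverse    : ∀ x → x ≢ 0# → ∃ λ y → x * y ≡ 1#
    elems      : List Carrier
    complete   : ∀ x → x ∈ elems
    unique     : Unique elems
    size       : length elems ≡ q

pow : {A : Set} → Op₂ A → A → A → ℕ → A
pow _*_ one x zero    = one
pow _*_ one x (suc n) = x * pow _*_ one x n

-- b mod m as a natural number in [0, m) (m = 0 never occurs in use).
modNat : ℤ → ℕ → ℕ
modNat b zero    = zero
modNat b (suc m) = b %ℕ suc m

natWith : {A : Set} → Op₂ A → A → A → ℕ → A
natWith _+_ z o zero    = z
natWith _+_ z o (suc n) = o + natWith _+_ z o n

sumWith : {A : Set} → Op₂ A → A → List A → A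
sumWith _+_ zero' = foldr _+_ zero'

-- Abstract model of (Z[ε_{q-1}], 𝔭', χ_q): a characteristic-zero integral domain R,
-- a ring homomorphism π : R → F_q (reduction modulo 𝔭'), and the Teichmüller
-- character χ : F_q → R, with χ(0) = 0, χ(λ)^(q-1) = 1 and χ(λ) ≡ λ mod 𝔭' for λ ≠ 0.
record Teichmuller {q : ℕ} (F : FiniteField q) : Set₁ where
  module F = FiniteField F
  infixl 6 _+_
  infixl 7 _*_
  field
    Carrier    : Set
    _+_ _*_    : Op₂ Carrier
    -_         : Op₁ Carrier
    0# 1#      : Carrier
    isCommRing : AS.IsCommutativeRing _≡_ _+_ _*_ -_ 0# 1#
    0≢1        : 0# ≢ 1#
    noZeroDiv  : ∀ x y → x * y ≡ 0# → x ≡ 0# ⊎ y ≡ 0#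
    charZero   : ∀ n → natWith _+_ 0# 1# (suc n) ≢ 0#
    π          : Carrier → F.Carrier
    π-+        : ∀ x y → π (x + y) ≡ F._+_ (π x) (π y)
    π-*        : ∀ x y → π (x * y) ≡ F._*_ (π x) (π y)
    π-1        : π 1# ≡ F.1#
    χ          : F.Carrier → Carrier
    χ-0        : χ F.0# ≡ 0#
    χ-root     : ∀ λ' → λ' ≢ F.0# → pow _*_ 1# (χ λ') (ℕ.pred q) ≡ 1#
    χ-red      : ∀ λ' → λ' ≢ F.0# → π (χ λ') ≡ λ'

  χ^ : ℤ → F.Carrier → Carrier
  χ^ b x with x F.≟ F.0#
  ... | yes _ = 0#
  ... | no  _ = pow _*_ 1# (χ x) (modNat b (ℕ.pred q))

  -- J^{(b,c)} = - Σ_{z1 + z2 + 1 = 0} χ^b(z1) χ^c(z2)   (z2 = -(1 + z1))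
  J : ℤ → ℤ → Carrier
  J b c = - sumWith _+_ 0#
            (map (λ z₁ → χ^ b z₁ * χ^ c (F.-_ (F._+_ F.1# z₁))) F.elems)

  c₁-sum : F.Carrier → ℕ → ℕ → ℕ → Carrier
  c₁-sum α a₁ a₂ a₃ = sumWith _+_ 0#
    (map (λ i → χ^ (ℤ.+ a₃ ℤ.- ℤ.+ i) α
                * J (ℤ.+ a₁ ℤ.+ ℤ.+ i) (ℤ.+ a₂)
                * J (ℤ.- ℤ.+ i) (ℤ.+ a₃))
         (upTo (ℕ.pred q)))

  -- c is the value c₁(α,q) = (q-1)^{-1} (-1)^{a2+a3} c₁-sum, i.e. the (unique, R being
  -- a characteristic-zero domain) element with (q-1)·c = (-1)^{a2+a3} · c₁-sum.
  Isc₁ : F.Carrier → ℕ → ℕ → ℕ → Carrier → Set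
  Isc₁ α a₁ a₂ a₃ c =
    natWith _+_ 0# 1# (ℕ.pred q) * c ≡ pow _*_ 1# (- 1#) (a₂ ℕ.+ a₃) * c₁-sum α a₁ a₂ a₃

{-# OPTIONS --safe #-}
-- Expanding both Jacobi sums turns the sum over i into the character sum
-- Σ_{i<q-1} χ^i(x) χ^{-i}(αy), which by orthogonality vanishes unless x = αy.  Hence
-- (q-1)·c₁ = ±(q-1)·Σ_y E(y) with E(y) = χ^{a₂}(α) χ^{a₁}(αy) χ^{a₂}(-1-αy) χ^{a₂}(-1-y).
-- The involution y ↦ (αy)⁻¹ of 𝔽_q multiplies E(y) by χ^{a₁+a₂}(α), because
-- 2(a₁+a₂) ≡ 0 mod q-1.  The hypotheses force a₁+a₂ to be an odd multiple of (q-1)/2, and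
-- α is a non-square, so this factor is -1: the sum equals its negative and, in
-- characteristic 0, vanishes.  That χ is multiplicative is not part of the model; it holds
-- because (q-1)-th roots of unity are separated by reduction mod 𝔭'.
module Submission where

open import Level using (0ℓ)
open import Algebra.Bundles using (CommutativeRing)
open import Algebra.Core using (Op₁; Op₂)
open import Algebra.Structures using (IsCommutativeRing)
import Algebra.Solver.CommutativeMonoid as CommutativeMonoidSolver
open import Data.Empty using (⊥; ⊥-elim)
open import Data.Integer as ℤ using (ℤ; -[1+_]; _%ℕ_; _/ℕ_)
import Data.Integer.DivMod as ℤ
import Data.Integer.Properties as ℤ
import Data.Integer.Tactic.RingSolver as ℤ-Solver
open import Data.List using (List; []; _∷_; _++_; [_]; map; upTo; length)
open import Data.List.Membership.Propositional using (_∈_)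
open import Data.List.Properties using (applyUpTo-∷ʳ; length-upTo)
import Data.List.Relation.Unary.All as All
open import Data.List.Relation.Unary.AllPairs using (_∷_)
open import Data.List.Relation.Unary.Any using (here; there)
open import Data.List.Relation.Unary.Unique.Propositional using (Unique)
open import Data.Maybe using (nothing)
open import Data.Nat as ℕ using (ℕ; zero; suc)
open import Data.Nat.Divisibility using (_∣_; divides)
import Data.Nat.DivMod as ℕ
import Data.Nat.Properties as ℕ
import Data.Nat.Tactic.RingSolver as ℕ-Solver
open import Data.Product using (∃; _,_; proj₁; proj₂)
open import Data.Sum using (_⊎_; inj₁; inj₂)
open import Function using (_∘_; id)
open import Relation.Binary.Definitions using (DecidableEquality)
open import Relation.Binary.PropositionalEquality
  using (_≡_; _≢_; refl; sym; trans; cong; cong₂; subst; subst₂; module ≡-Reasoning)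
open import Relation.Nullary using (yes; no; ¬_)
open import Tactic.RingSolver.Core.AlmostCommutativeRing using (fromCommutativeRing)
import Tactic.RingSolver.NonReflective
open import Defs

congruence-+ : ∀ {b c x y z qb qc q k : ℤ} → b ≡ x ℤ.+ qb ℤ.* k → c ≡ y ℤ.+ qc ℤ.* k → b ℤ.+ c ≡ z ℤ.+ q ℤ.* k →
               x ℤ.+ y ≡ z ℤ.+ (q ℤ.- qb ℤ.- qc) ℤ.* k
congruence-+ {x = x} {y} {z} {qb} {qc} {q} {k} refl refl b+c≡z+qk = begin
  x ℤ.+ y                                                  ≡⟨ ℤ-Solver.solve (x ∷ y ∷ qb ∷ qc ∷ k ∷ []) ⟩
  (x ℤ.+ qb ℤ.* k) ℤ.+ (y ℤ.+ qc ℤ.* k) ℤ.- (qb ℤ.+ qc) ℤ.* k  ≡⟨ cong (ℤ._- (qb ℤ.+ qc) ℤ.* k) b+c≡z+qk ⟩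
  (z ℤ.+ q ℤ.* k) ℤ.- (qb ℤ.+ qc) ℤ.* k                     ≡⟨ ℤ-Solver.solve (z ∷ q ∷ qb ∷ qc ∷ k ∷ []) ⟩
  z ℤ.+ (q ℤ.- qb ℤ.- qc) ℤ.* k                              ∎
  where open ≡-Reasoning

shift-multiple : ∀ {m n z k : ℤ} → m ≡ n ℤ.+ z ℤ.* k → n ≡ m ℤ.+ (ℤ.- z) ℤ.* k
shift-multiple {n = n} {z} {k} refl = ℤ-Solver.solve (n ∷ z ∷ k ∷ [])

x+y+y≡-x+[[x+y]+[x+y]] : ∀ (x y : ℤ) → x ℤ.+ y ℤ.+ y ≡ ℤ.- x ℤ.+ ((x ℤ.+ y) ℤ.+ (x ℤ.+ y))
x+y+y≡-x+[[x+y]+[x+y]] = ℤ-Solver.solve-∀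

module CommutativeRingProperties {A : Set} (plus times : Op₂ A) (neg : Op₁ A) (zero′ one : A)
  (isCommRing : IsCommutativeRing _≡_ plus times neg zero′ one) where

  commutativeRing : CommutativeRing 0ℓ 0ℓ
  commutativeRing = record { isCommutativeRing = isCommRing }

  open CommutativeRing commutativeRing public
    using ( _+_; _*_; -_; 0#; 1#; _-_; +-comm; +-assoc; *-comm; *-assoc; +-identityˡ; +-identityʳ
          ; *-identityˡ; *-identityʳ; distribˡ; distribʳ; zeroˡ; zeroʳ
          ; -‿inverseˡ; -‿inverseʳ )
  open CommutativeRing commutativeRing
    using (ring; +-group; commutativeSemiring; *-commutativeMonoid)
  open import Algebra.Properties.Ring ring public using (-‿distribˡ-*; -‿distribʳ-*; -1*x≈-x; [y-z]x≈yx-zx)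
  open import Algebra.Properties.Group +-group public
    using (identityʳ-unique; inverseʳ-unique; x∙y⁻¹≈ε⇒x≈y; ⁻¹-anti-homo-∙; ε⁻¹≈ε; ⁻¹-involutive)
  open import Algebra.Properties.CommutativeSemiring.Exp commutativeSemiring public
    using (_^_; ^-homo-*; ^-assocʳ; ^-distrib-*)
  module +*-Solver = Tactic.RingSolver.NonReflective (fromCommutativeRing commutativeRing (λ _ → nothing))
  open +*-Solver using (solve; _⊜_; _⊕_)
  module *-Solver = CommutativeMonoidSolver *-commutativeMonoid
  open ≡-Reasoning

  pow≡^ : ∀ x n → pow _*_ 1# x n ≡ x ^ n
  pow≡^ x zero    = refl
  pow≡^ x (suc n) = cong (x *_) (pow≡^ x n)

  1^n≡1 : ∀ n → 1# ^ n ≡ 1#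
  1^n≡1 zero    = refl
  1^n≡1 (suc n) = trans (cong (1# *_) (1^n≡1 n)) (*-identityˡ 1#)

  ^-*-K≡1 : ∀ {u K} → u ^ K ≡ 1# → ∀ j → u ^ (j ℕ.* K) ≡ 1#
  ^-*-K≡1 {u} {K} uᴷ≡1 j = begin
    u ^ (j ℕ.* K)   ≡⟨ cong (u ^_) (ℕ.*-comm j K) ⟩
    u ^ (K ℕ.* j)   ≡⟨ sym (^-assocʳ u K j) ⟩
    (u ^ K) ^ j     ≡⟨ cong (_^ j) uᴷ≡1 ⟩
    1# ^ j          ≡⟨ 1^n≡1 j ⟩
    1#              ∎

  ^-+-*K : ∀ {u K} → u ^ K ≡ 1# → ∀ n j → u ^ (n ℕ.+ j ℕ.* K) ≡ u ^ n
  ^-+-*K {u} {K} uᴷ≡1 n j = begin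
    u ^ (n ℕ.+ j ℕ.* K)        ≡⟨ ^-homo-* u n (j ℕ.* K) ⟩
    u ^ n * u ^ (j ℕ.* K)      ≡⟨ cong (u ^ n *_) (^-*-K≡1 uᴷ≡1 j) ⟩
    u ^ n * 1#                 ≡⟨ *-identityʳ (u ^ n) ⟩
    u ^ n                      ∎

  ^-periodic : ∀ {u K} → u ^ K ≡ 1# → ∀ {m n} z → ℤ.+ m ≡ ℤ.+ n ℤ.+ z ℤ.* ℤ.+ K → u ^ m ≡ u ^ n
  ^-periodic {u} {K} uᴷ≡1 {m} {n} (ℤ.+ j) m≡n+jK = trans (cong (u ^_) (ℤ.+-injective (begin
    ℤ.+ m                              ≡⟨ m≡n+jK ⟩
    ℤ.+ n ℤ.+ ℤ.+ j ℤ.* ℤ.+ K          ≡⟨ cong (λ z → ℤ.+ n ℤ.+ z) (sym (ℤ.pos-* j K)) ⟩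
    ℤ.+ n ℤ.+ ℤ.+ (j ℕ.* K)            ≡⟨ sym (ℤ.pos-+ n (j ℕ.* K)) ⟩
    ℤ.+ (n ℕ.+ j ℕ.* K)                ∎))) (^-+-*K uᴷ≡1 n j)
  ^-periodic {K = K} uᴷ≡1 {m} {n} -[1+ j ] m≡n-[1+j]K =
    sym (^-periodic {K = K} uᴷ≡1 {n} {m} (ℤ.+ suc j) (shift-multiple {ℤ.+ m} {ℤ.+ n} { -[1+ j ]} {ℤ.+ K} m≡n-[1+j]K))

  -1^odd≡-1 : ∀ s → (- 1#) ^ suc (s ℕ.+ s) ≡ - 1#
  -1^odd≡-1 s = begin
    - 1# * (- 1#) ^ (s ℕ.+ s)             ≡⟨ cong (- 1# *_) (^-homo-* (- 1#) s s) ⟩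
    - 1# * ((- 1#) ^ s * (- 1#) ^ s)      ≡⟨ cong (- 1# *_) (sym (^-distrib-* (- 1#) (- 1#) s)) ⟩
    - 1# * (- 1# * - 1#) ^ s              ≡⟨ cong (λ z → - 1# * z ^ s) (trans (-1*x≈-x (- 1#)) (⁻¹-involutive 1#)) ⟩
    - 1# * 1# ^ s                         ≡⟨ cong (- 1# *_) (1^n≡1 s) ⟩
    - 1# * 1#                             ≡⟨ *-identityʳ (- 1#) ⟩
    - 1#                                  ∎

  -x*-y≡x*y : ∀ x y → - x * - y ≡ x * y
  -x*-y≡x*y x y = begin
    - x * - y       ≡⟨ sym (-‿distribʳ-* (- x) y) ⟩
    - (- x * y)     ≡⟨ cong -_ (sym (-‿distribˡ-* x y)) ⟩
    - - (x * y)     ≡⟨ ⁻¹-involutive (x * y) ⟩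
    x * y           ∎

  fromℕ : ℕ → A
  fromℕ = natWith _+_ 0# 1#

  fromℕ-+ : ∀ m n → fromℕ (m ℕ.+ n) ≡ fromℕ m + fromℕ n
  fromℕ-+ zero    n = sym (+-identityˡ _)
  fromℕ-+ (suc m) n = trans (cong (1# +_) (fromℕ-+ m n)) (sym (+-assoc _ _ _))

  ∑ : {B : Set} → List B → (B → A) → A
  ∑ xs f = sumWith _+_ 0# (map f xs)

  syntax ∑ xs (λ x → e) = ∑[ x ∈ xs ] e

  module _ {B : Set} where

    ∑-cong : ∀ {f g : B → A} → (∀ x → f x ≡ g x) → ∀ xs → ∑ xs f ≡ ∑ xs g
    ∑-cong f≗g []       = refl
    ∑-cong f≗g (x ∷ xs) = cong₂ _+_ (f≗g x) (∑-cong f≗g xs)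

    ∑-zero : ∀ (f : B → A) xs → (∀ x → x ∈ xs → f x ≡ 0#) → ∑ xs f ≡ 0#
    ∑-zero f []       _    = refl
    ∑-zero f (x ∷ xs) f≡0 = begin
      f x + ∑ xs f  ≡⟨ cong₂ _+_ (f≡0 x (here refl)) (∑-zero f xs (λ y y∈xs → f≡0 y (there y∈xs))) ⟩
      0# + 0#       ≡⟨ +-identityˡ 0# ⟩
      0#            ∎

    ∑-distrib-+ : ∀ (f g : B → A) xs → ∑[ x ∈ xs ] (f x + g x) ≡ ∑ xs f + ∑ xs g
    ∑-distrib-+ f g []       = sym (+-identityˡ 0#)
    ∑-distrib-+ f g (x ∷ xs) = begin
      (f x + g x) + ∑[ x ∈ xs ] (f x + g x)  ≡⟨ cong ((f x + g x) +_) (∑-distrib-+ f g xs) ⟩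
      (f x + g x) + (∑ xs f + ∑ xs g)        ≡⟨ solve 4 (λ a b c d → ((a ⊕ b) ⊕ (c ⊕ d)) ⊜ ((a ⊕ c) ⊕ (b ⊕ d))) refl
                                                   (f x) (g x) (∑ xs f) (∑ xs g) ⟩
      (f x + ∑ xs f) + (g x + ∑ xs g)        ∎

    *-distribˡ-∑ : ∀ c (f : B → A) xs → c * ∑ xs f ≡ ∑[ x ∈ xs ] (c * f x)
    *-distribˡ-∑ c f []       = zeroʳ c
    *-distribˡ-∑ c f (x ∷ xs) = trans (distribˡ c (f x) (∑ xs f)) (cong (c * f x +_) (*-distribˡ-∑ c f xs))

    *-distribʳ-∑ : ∀ c (f : B → A) xs → ∑ xs f * c ≡ ∑[ x ∈ xs ] (f x * c)
    *-distribʳ-∑ c f xs = begin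
      ∑ xs f * c             ≡⟨ *-comm _ c ⟩
      c * ∑ xs f             ≡⟨ *-distribˡ-∑ c f xs ⟩
      ∑[ x ∈ xs ] (c * f x)  ≡⟨ ∑-cong (λ x → *-comm c (f x)) xs ⟩
      ∑[ x ∈ xs ] (f x * c)  ∎

    -‿distrib-∑ : ∀ (f : B → A) xs → - ∑ xs f ≡ ∑[ x ∈ xs ] (- f x)
    -‿distrib-∑ f []       = ε⁻¹≈ε
    -‿distrib-∑ f (x ∷ xs) = begin
      - (f x + ∑ xs f)    ≡⟨ ⁻¹-anti-homo-∙ (f x) (∑ xs f) ⟩
      - ∑ xs f + - f x    ≡⟨ +-comm _ _ ⟩
      - f x + - ∑ xs f    ≡⟨ cong (- f x +_) (-‿distrib-∑ f xs) ⟩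
      - f x + ∑[ x ∈ xs ] (- f x)  ∎

    ∑-++ : ∀ (f : B → A) xs ys → ∑ (xs ++ ys) f ≡ ∑ xs f + ∑ ys f
    ∑-++ f []       ys = sym (+-identityˡ _)
    ∑-++ f (x ∷ xs) ys = trans (cong (f x +_) (∑-++ f xs ys)) (sym (+-assoc _ _ _))

    ∑-const-1 : ∀ (xs : List B) → ∑[ x ∈ xs ] 1# ≡ fromℕ (length xs)
    ∑-const-1 []       = refl
    ∑-const-1 (x ∷ xs) = cong (1# +_) (∑-const-1 xs)

    ∑-single : ∀ (f : B → A) xs → Unique xs → ∀ {t} → t ∈ xs → (∀ x → x ≢ t → f x ≡ 0#) → ∑ xs f ≡ f t
    ∑-single f (x ∷ xs) (x∉xs ∷ _) (here refl) f≡0 = begin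
      f x + ∑ xs f  ≡⟨ cong (f x +_) (∑-zero f xs (λ y y∈xs → f≡0 y (λ y≡x → All.lookup x∉xs y∈xs (sym y≡x)))) ⟩
      f x + 0#      ≡⟨ +-identityʳ (f x) ⟩
      f x           ∎
    ∑-single f (x ∷ xs) (x∉xs ∷ xs!) {t} (there t∈xs) f≡0 = begin
      f x + ∑ xs f  ≡⟨ cong₂ _+_ (f≡0 x (λ x≡t → All.lookup x∉xs t∈xs x≡t)) (∑-single f xs xs! t∈xs f≡0) ⟩
      0# + f t      ≡⟨ +-identityˡ (f t) ⟩
      f t           ∎

  ∑-comm : ∀ {B C : Set} (f : B → C → A) xs ys →
           ∑[ x ∈ xs ] ∑[ y ∈ ys ] f x y ≡ ∑[ y ∈ ys ] ∑[ x ∈ xs ] f x y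
  ∑-comm f []       ys = sym (∑-zero _ ys (λ _ _ → refl))
  ∑-comm f (x ∷ xs) ys = begin
    ∑ ys (f x) + ∑[ x ∈ xs ] ∑ ys (f x)                ≡⟨ cong (∑ ys (f x) +_) (∑-comm f xs ys) ⟩
    ∑ ys (f x) + ∑[ y ∈ ys ] ∑[ x ∈ xs ] f x y         ≡⟨ sym (∑-distrib-+ (f x) (λ y → ∑[ x ∈ xs ] f x y) ys) ⟩
    ∑[ y ∈ ys ] (f x y + ∑[ x ∈ xs ] f x y)            ∎

  ∑-upTo-suc : ∀ (f : ℕ → A) n → ∑ (upTo (suc n)) f ≡ ∑ (upTo n) f + f n
  ∑-upTo-suc f n = begin
    ∑ (upTo (suc n)) f        ≡⟨ cong (λ xs → ∑ xs f) (sym (applyUpTo-∷ʳ (λ i → i) n)) ⟩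
    ∑ (upTo n ++ [ n ]) f     ≡⟨ ∑-++ f (upTo n) [ n ] ⟩
    ∑ (upTo n) f + (f n + 0#) ≡⟨ cong (∑ (upTo n) f +_) (+-identityʳ (f n)) ⟩
    ∑ (upTo n) f + f n        ∎

  geometric-sum : ∀ w n → (1# - w) * (∑[ i ∈ upTo n ] (w ^ i)) ≡ 1# - w ^ n
  geometric-sum w zero    = trans (zeroʳ _) (sym (-‿inverseʳ 1#))
  geometric-sum w (suc n) = begin
    (1# - w) * (∑[ i ∈ upTo (suc n) ] (w ^ i))               ≡⟨ cong ((1# - w) *_) (∑-upTo-suc (w ^_) n) ⟩
    (1# - w) * (∑[ i ∈ upTo n ] (w ^ i) + w ^ n)            ≡⟨ distribˡ (1# - w) _ (w ^ n) ⟩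
    (1# - w) * (∑[ i ∈ upTo n ] (w ^ i)) + (1# - w) * w ^ n  ≡⟨ cong (_+ (1# - w) * w ^ n) (geometric-sum w n) ⟩
    (1# - w ^ n) + (1# - w) * w ^ n                         ≡⟨ cong (1# - w ^ n +_) ([y-z]x≈yx-zx (w ^ n) 1# w) ⟩
    (1# - w ^ n) + (1# * w ^ n - w * w ^ n)                 ≡⟨ cong (λ z → (1# - w ^ n) + (z - w * w ^ n)) (*-identityˡ (w ^ n)) ⟩
    (1# - w ^ n) + (w ^ n - w * w ^ n)                      ≡⟨ solve 4 (λ o p -p -r → ((o ⊕ -p) ⊕ (p ⊕ -r)) ⊜ ((o ⊕ -r) ⊕ (-p ⊕ p)))
                                                                 refl 1# (w ^ n) (- w ^ n) (- (w * w ^ n)) ⟩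
    (1# - w * w ^ n) + (- w ^ n + w ^ n)                    ≡⟨ cong (1# - w * w ^ n +_) (-‿inverseˡ (w ^ n)) ⟩
    (1# - w * w ^ n) + 0#                                   ≡⟨ +-identityʳ _ ⟩
    1# - w * w ^ n                                          ∎

  module _ (noZeroDivisors : ∀ x y → x * y ≡ 0# → x ≡ 0# ⊎ y ≡ 0#) where

    root-of-unity-dichotomy : ∀ w n → w ^ n ≡ 1# → w ≡ 1# ⊎ ∑[ i ∈ upTo n ] (w ^ i) ≡ 0#
    root-of-unity-dichotomy w n wⁿ≡1 with noZeroDivisors (1# - w) _ product≡0
      where
      product≡0 : (1# - w) * (∑[ i ∈ upTo n ] (w ^ i)) ≡ 0#
      product≡0 = trans (geometric-sum w n) (trans (cong (λ z → 1# - z) wⁿ≡1) (-‿inverseʳ 1#))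
    ... | inj₁ 1-w≡0 = inj₁ (sym (x∙y⁻¹≈ε⇒x≈y 1# w 1-w≡0))
    ... | inj₂ sum≡0 = inj₂ sum≡0

    x*x≡1⇒x≡1⊎x≡-1 : ∀ x → x * x ≡ 1# → x ≡ 1# ⊎ x ≡ - 1#
    x*x≡1⇒x≡1⊎x≡-1 x x*x≡1 with noZeroDivisors (x - 1#) (x + 1#) product≡0
      where
      product≡0 : (x - 1#) * (x + 1#) ≡ 0#
      product≡0 = begin
        (x - 1#) * (x + 1#)                    ≡⟨ [y-z]x≈yx-zx (x + 1#) x 1# ⟩
        x * (x + 1#) - 1# * (x + 1#)           ≡⟨ cong₂ _-_ (distribˡ x x 1#) (*-identityˡ (x + 1#)) ⟩
        (x * x + x * 1#) - (x + 1#)            ≡⟨ cong₂ (λ a b → (a + b) - (x + 1#)) x*x≡1 (*-identityʳ x) ⟩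
        (1# + x) - (x + 1#)                    ≡⟨ cong (λ z → (1# + x) - z) (+-comm x 1#) ⟩
        (1# + x) - (1# + x)                    ≡⟨ -‿inverseʳ (1# + x) ⟩
        0#                                     ∎
    ... | inj₁ x-1≡0 = inj₁ (x∙y⁻¹≈ε⇒x≈y x 1# x-1≡0)
    ... | inj₂ x+1≡0 = inj₂ (inverseʳ-unique 1# x (trans (+-comm 1# x) x+1≡0))

  module FiniteSum {B : Set} (_≟_ : DecidableEquality B) (elems : List B)
                   (complete : ∀ x → x ∈ elems) (unique : Unique elems) where

    δ : B → B → A
    δ x y with x ≟ y
    ... | yes _ = 1#
    ... | no  _ = 0#

    δ-refl : ∀ x → δ x x ≡ 1#
    δ-refl x with x ≟ x
    ... | yes _  = refl
    ... | no x≢x = ⊥-elim (x≢x refl)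

    δ-≢ : ∀ {x y} → x ≢ y → δ x y ≡ 0#
    δ-≢ {x} {y} x≢y with x ≟ y
    ... | yes x≡y = ⊥-elim (x≢y x≡y)
    ... | no  _   = refl

    ∑-point : ∀ (f : B → A) t → (∀ x → x ≢ t → f x ≡ 0#) → ∑ elems f ≡ f t
    ∑-point f t = ∑-single f elems unique (complete t)

    ∑-δ : ∀ (g : B → A) t → ∑[ x ∈ elems ] (δ x t * g x) ≡ g t
    ∑-δ g t = begin
      ∑[ x ∈ elems ] (δ x t * g x)  ≡⟨ ∑-point _ t (λ x x≢t → trans (cong (_* g x) (δ-≢ x≢t)) (zeroˡ (g x))) ⟩
      δ t t * g t                    ≡⟨ cong (_* g t) (δ-refl t) ⟩
      1# * g t                       ≡⟨ *-identityˡ (g t) ⟩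
      g t                            ∎

    ∑-reindex : ∀ (σ τ : B → B) → (∀ x → σ (τ x) ≡ x) → (∀ y → τ (σ y) ≡ y) →
                ∀ f → ∑[ y ∈ elems ] f (σ y) ≡ ∑ elems f
    ∑-reindex σ τ στ τσ f = begin
      ∑[ y ∈ elems ] f (σ y)                            ≡⟨ ∑-cong (λ y → sym (∑-δ f (σ y))) elems ⟩
      ∑[ y ∈ elems ] ∑[ x ∈ elems ] (δ x (σ y) * f x)   ≡⟨ ∑-comm (λ y x → δ x (σ y) * f x) elems elems ⟩
      ∑[ x ∈ elems ] ∑[ y ∈ elems ] (δ x (σ y) * f x)   ≡⟨ ∑-cong inner elems ⟩
      ∑ elems f                                         ∎
      where
      σ-hits-only-τ : ∀ x y → y ≢ τ x → δ x (σ y) ≡ 0#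
      σ-hits-only-τ x y y≢τx = δ-≢ (λ x≡σy → y≢τx (trans (sym (τσ y)) (cong τ (sym x≡σy))))

      inner : ∀ x → ∑[ y ∈ elems ] (δ x (σ y) * f x) ≡ f x
      inner x = begin
        ∑[ y ∈ elems ] (δ x (σ y) * f x)  ≡⟨ ∑-point _ (τ x) (λ y y≢τx → trans (cong (_* f x) (σ-hits-only-τ x y y≢τx)) (zeroˡ (f x))) ⟩
        δ x (σ (τ x)) * f x               ≡⟨ cong (λ z → δ x z * f x) (στ x) ⟩
        δ x x * f x                       ≡⟨ cong (_* f x) (δ-refl x) ⟩
        1# * f x                          ≡⟨ *-identityˡ (f x) ⟩
        f x                               ∎

module FiniteFieldProperties {q : ℕ} (F : FiniteField q) where

  open FiniteField F public using (Carrier; _≟_; elems)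
  open FiniteField F using (0≢1; inverse; complete; unique; size)
  open CommutativeRingProperties (FiniteField._+_ F) (FiniteField._*_ F) (FiniteField.-_ F)
    (FiniteField.0# F) (FiniteField.1# F) (FiniteField.isCommRing F) public
  open FiniteSum _≟_ elems complete unique public
  open ≡-Reasoning

  1≢0 : 1# ≢ 0#
  1≢0 1≡0 = 0≢1 (sym 1≡0)

  case-0-≢0 : ∀ {P : Carrier → Set} → P 0# → (∀ {x} → x ≢ 0# → P x) → ∀ x → P x
  case-0-≢0 P0 P≢0 x with x ≟ 0#
  ... | yes refl = P0
  ... | no  x≢0  = P≢0 x≢0

  _⁻¹ : Carrier → Carrier
  x ⁻¹ with x ≟ 0#
  ... | yes _   = 0#
  ... | no  x≢0 = proj₁ (inverse x x≢0)

  0⁻¹≡0 : 0# ⁻¹ ≡ 0#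
  0⁻¹≡0 with 0# ≟ 0#
  ... | yes _    = refl
  ... | no  0≢0  = ⊥-elim (0≢0 refl)

  x*x⁻¹≡1 : ∀ {x} → x ≢ 0# → x * x ⁻¹ ≡ 1#
  x*x⁻¹≡1 {x} x≢0 with x ≟ 0#
  ... | yes x≡0  = ⊥-elim (x≢0 x≡0)
  ... | no  x≢0′ = proj₂ (inverse x x≢0′)

  x*y≡1⇒x≢0 : ∀ {x y} → x * y ≡ 1# → x ≢ 0#
  x*y≡1⇒x≢0 {x} {y} xy≡1 x≡0 = 1≢0 (begin
    1#      ≡⟨ sym xy≡1 ⟩
    x * y   ≡⟨ cong (_* y) x≡0 ⟩
    0# * y  ≡⟨ zeroˡ y ⟩
    0#      ∎)

  x*y≡1⇒y≢0 : ∀ {x y} → x * y ≡ 1# → y ≢ 0#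
  x*y≡1⇒y≢0 {x} {y} xy≡1 = x*y≡1⇒x≢0 (trans (*-comm y x) xy≡1)

  ⁻¹-unique : ∀ x y → x * y ≡ 1# → x ⁻¹ ≡ y
  ⁻¹-unique x y xy≡1 = begin
    x ⁻¹              ≡⟨ sym (*-identityʳ _) ⟩
    x ⁻¹ * 1#         ≡⟨ cong (x ⁻¹ *_) (sym xy≡1) ⟩
    x ⁻¹ * (x * y)    ≡⟨ sym (*-assoc _ _ _) ⟩
    (x ⁻¹ * x) * y    ≡⟨ cong (_* y) (trans (*-comm _ _) (x*x⁻¹≡1 (x*y≡1⇒x≢0 xy≡1))) ⟩
    1# * y            ≡⟨ *-identityˡ y ⟩
    y                 ∎

  noZeroDivisors : ∀ x y → x * y ≡ 0# → x ≡ 0# ⊎ y ≡ 0#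
  noZeroDivisors x y xy≡0 with x ≟ 0#
  ... | yes x≡0 = inj₁ x≡0
  ... | no  x≢0 = inj₂ (begin
    y                 ≡⟨ sym (*-identityˡ y) ⟩
    1# * y            ≡⟨ cong (_* y) (sym (trans (*-comm _ _) (x*x⁻¹≡1 x≢0))) ⟩
    (x ⁻¹ * x) * y    ≡⟨ *-assoc _ x y ⟩
    x ⁻¹ * (x * y)    ≡⟨ cong (x ⁻¹ *_) xy≡0 ⟩
    x ⁻¹ * 0#         ≡⟨ zeroʳ _ ⟩
    0#                ∎)

  *-≢0 : ∀ {x y} → x ≢ 0# → y ≢ 0# → x * y ≢ 0#
  *-≢0 x≢0 y≢0 xy≡0 with noZeroDivisors _ _ xy≡0
  ... | inj₁ x≡0 = x≢0 x≡0
  ... | inj₂ y≡0 = y≢0 y≡0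

  -- Translating by 1 permutes the field, so Σ x = Σ (1 + x) = q·1 + Σ x.
  characteristic : fromℕ q ≡ 0#
  characteristic = identityʳ-unique (∑ elems id) (fromℕ q) (begin
    ∑ elems id + fromℕ q                ≡⟨ +-comm _ _ ⟩
    fromℕ q + ∑ elems id                ≡⟨ cong (λ n → fromℕ n + ∑ elems id) (sym size) ⟩
    fromℕ (length elems) + ∑ elems id   ≡⟨ cong (_+ ∑ elems id) (sym (∑-const-1 elems)) ⟩
    ∑[ x ∈ elems ] 1# + ∑ elems id      ≡⟨ sym (∑-distrib-+ (λ _ → 1#) id elems) ⟩
    ∑[ x ∈ elems ] (1# + x)             ≡⟨ ∑-reindex (1# +_) (- 1# +_) (cancel (-‿inverseʳ 1#)) (cancel (-‿inverseˡ 1#)) id ⟩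
    ∑ elems id                          ∎)
    where
    cancel : ∀ {a b} → a + b ≡ 0# → ∀ x → a + (b + x) ≡ x
    cancel {a} {b} a+b≡0 x = trans (sym (+-assoc a b x)) (trans (cong (_+ x) a+b≡0) (+-identityˡ x))

  1+1≢0 : ∀ r → q ≡ suc (r ℕ.+ r) → 1# + 1# ≢ 0#
  1+1≢0 r q≡2r+1 1+1≡0 = 1≢0 (begin
    1#                      ≡⟨ sym (+-identityʳ 1#) ⟩
    1# + 0#                 ≡⟨ cong (1# +_) (sym 2r≡0) ⟩
    fromℕ (suc (r ℕ.+ r))   ≡⟨ cong fromℕ (sym q≡2r+1) ⟩
    fromℕ q                 ≡⟨ characteristic ⟩
    0#                      ∎)
    where
    2r≡0 : fromℕ (r ℕ.+ r) ≡ 0#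
    2r≡0 = begin
      fromℕ (r ℕ.+ r)                ≡⟨ fromℕ-+ r r ⟩
      fromℕ r + fromℕ r              ≡⟨ sym (cong₂ _+_ (*-identityˡ _) (*-identityˡ _)) ⟩
      1# * fromℕ r + 1# * fromℕ r    ≡⟨ sym (distribʳ _ 1# 1#) ⟩
      (1# + 1#) * fromℕ r            ≡⟨ cong (_* fromℕ r) 1+1≡0 ⟩
      0# * fromℕ r                   ≡⟨ zeroˡ _ ⟩
      0#                             ∎

module TeichmullerProperties {k : ℕ} {F : FiniteField (suc (suc k))} (T : Teichmuller F) where

  K : ℕ
  K = suc k

  module 𝔽 = FiniteFieldProperties F
  open Teichmuller T using (Carrier; π; π-+; π-*; π-1; χ; χ-root; χ-red; χ^; J; c₁-sum; Isc₁; noZeroDiv; charZero)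
  open CommutativeRingProperties (Teichmuller._+_ T) (Teichmuller._*_ T) (Teichmuller.-_ T)
    (Teichmuller.0# T) (Teichmuller.1# T) (Teichmuller.isCommRing T) public
  open FiniteSum 𝔽._≟_ 𝔽.elems (FiniteField.complete F) (FiniteField.unique F)
  open ≡-Reasoning

  π-0 : π 0# ≡ 𝔽.0#
  π-0 = 𝔽.identityʳ-unique (π 0#) (π 0#) (trans (sym (π-+ 0# 0#)) (cong π (+-identityˡ 0#)))

  π-^ : ∀ x n → π (x ^ n) ≡ π x 𝔽.^ n
  π-^ x zero    = π-1
  π-^ x (suc n) = trans (π-* x (x ^ n)) (cong (π x 𝔽.*_) (π-^ x n))

  π-∑ : ∀ {B : Set} (f : B → Carrier) xs → π (∑ xs f) ≡ 𝔽.∑ xs (π ∘ f)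
  π-∑ f []       = π-0
  π-∑ f (x ∷ xs) = trans (π-+ (f x) (∑ xs f)) (cong (π (f x) 𝔽.+_) (π-∑ f xs))

  K≢0-in-𝔽 : 𝔽.fromℕ K ≢ 𝔽.0#
  K≢0-in-𝔽 K≡0 = 𝔽.1≢0 (begin
    𝔽.1#              ≡⟨ sym (𝔽.+-identityʳ 𝔽.1#) ⟩
    𝔽.1# 𝔽.+ 𝔽.0#     ≡⟨ cong (𝔽.1# 𝔽.+_) (sym K≡0) ⟩
    𝔽.fromℕ (suc K)   ≡⟨ 𝔽.characteristic ⟩
    𝔽.0#              ∎)

  -- If w = u·v^(K-1) = u·v⁻¹ were ≠ 1, then 1 + w + ⋯ + w^(K-1) = 0; but π w = 1, so π of that sum is K ≠ 0 in 𝔽.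
  roots-of-unity-π-injective : ∀ {u v} → u ^ K ≡ 1# → v ^ K ≡ 1# → π u ≡ π v → u ≡ v
  roots-of-unity-π-injective {u} {v} uᴷ≡1 vᴷ≡1 πu≡πv = u≡v (root-of-unity-dichotomy noZeroDiv w K wᴷ≡1)
    where
    w = u * v ^ k

    wᴷ≡1 : w ^ K ≡ 1#
    wᴷ≡1 = begin
      (u * v ^ k) ^ K        ≡⟨ ^-distrib-* u (v ^ k) K ⟩
      u ^ K * (v ^ k) ^ K    ≡⟨ cong₂ _*_ uᴷ≡1 (^-assocʳ v k K) ⟩
      1# * v ^ (k ℕ.* K)     ≡⟨ cong (1# *_) (^-*-K≡1 vᴷ≡1 k) ⟩
      1# * 1#                ≡⟨ *-identityˡ 1# ⟩
      1#                     ∎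

    πwⁱ≡1 : ∀ i → π (w ^ i) ≡ 𝔽.1#
    πwⁱ≡1 i = begin
      π (w ^ i)                      ≡⟨ π-^ w i ⟩
      π (u * v ^ k) 𝔽.^ i            ≡⟨ cong (𝔽._^ i) (trans (π-* u (v ^ k)) (cong (𝔽._* π (v ^ k)) πu≡πv)) ⟩
      (π v 𝔽.* π (v ^ k)) 𝔽.^ i      ≡⟨ cong (𝔽._^ i) (sym (π-* v (v ^ k))) ⟩
      π (v ^ K) 𝔽.^ i                ≡⟨ cong (λ z → π z 𝔽.^ i) vᴷ≡1 ⟩
      π 1# 𝔽.^ i                     ≡⟨ cong (𝔽._^ i) π-1 ⟩
      𝔽.1# 𝔽.^ i                     ≡⟨ 𝔽.1^n≡1 i ⟩
      𝔽.1#                           ∎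

    π∑wⁱ≡K : π (∑ (upTo K) (w ^_)) ≡ 𝔽.fromℕ K
    π∑wⁱ≡K = begin
      π (∑ (upTo K) (w ^_))         ≡⟨ π-∑ (w ^_) (upTo K) ⟩
      𝔽.∑ (upTo K) (π ∘ (w ^_))     ≡⟨ 𝔽.∑-cong πwⁱ≡1 (upTo K) ⟩
      𝔽.∑ (upTo K) (λ _ → 𝔽.1#)     ≡⟨ 𝔽.∑-const-1 (upTo K) ⟩
      𝔽.fromℕ (length (upTo K))     ≡⟨ cong 𝔽.fromℕ (length-upTo K) ⟩
      𝔽.fromℕ K                     ∎

    u≡v : w ≡ 1# ⊎ ∑ (upTo K) (w ^_) ≡ 0# → u ≡ v
    u≡v (inj₂ ∑≡0) = ⊥-elim (K≢0-in-𝔽 (trans (sym π∑wⁱ≡K) (trans (cong π ∑≡0) π-0)))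
    u≡v (inj₁ w≡1) = begin
      u                  ≡⟨ sym (*-identityʳ u) ⟩
      u * 1#             ≡⟨ cong (u *_) (sym vᴷ≡1) ⟩
      u * (v * v ^ k)    ≡⟨ *-Solver.solve 3 (λ u v p → (u ⊕ (v ⊕ p)) ⊜ ((u ⊕ p) ⊕ v)) refl u v (v ^ k) ⟩
      w * v              ≡⟨ cong (_* v) w≡1 ⟩
      1# * v             ≡⟨ *-identityˡ v ⟩
      v                  ∎
      where open *-Solver using (_⊕_; _⊜_)

  χᴷ≡1 : ∀ {x} → x ≢ 𝔽.0# → χ x ^ K ≡ 1#
  χᴷ≡1 {x} x≢0 = trans (sym (pow≡^ (χ x) K)) (χ-root x x≢0)

  χ-* : ∀ {x y} → x ≢ 𝔽.0# → y ≢ 𝔽.0# → χ (x 𝔽.* y) ≡ χ x * χ y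
  χ-* {x} {y} x≢0 y≢0 = roots-of-unity-π-injective (χᴷ≡1 (𝔽.*-≢0 x≢0 y≢0)) χxχyᴷ≡1 (begin
    π (χ (x 𝔽.* y))          ≡⟨ χ-red (x 𝔽.* y) (𝔽.*-≢0 x≢0 y≢0) ⟩
    x 𝔽.* y                  ≡⟨ sym (cong₂ 𝔽._*_ (χ-red x x≢0) (χ-red y y≢0)) ⟩
    π (χ x) 𝔽.* π (χ y)      ≡⟨ sym (π-* (χ x) (χ y)) ⟩
    π (χ x * χ y)            ∎)
    where
    χxχyᴷ≡1 : (χ x * χ y) ^ K ≡ 1#
    χxχyᴷ≡1 = trans (^-distrib-* (χ x) (χ y) K) (trans (cong₂ _*_ (χᴷ≡1 x≢0) (χᴷ≡1 y≢0)) (*-identityˡ 1#))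

  χ-1 : χ 𝔽.1# ≡ 1#
  χ-1 = roots-of-unity-π-injective (χᴷ≡1 𝔽.1≢0) (1^n≡1 K) (trans (χ-red 𝔽.1# 𝔽.1≢0) (sym π-1))

  χ-injective : ∀ {x y} → x ≢ 𝔽.0# → y ≢ 𝔽.0# → χ x ≡ χ y → x ≡ y
  χ-injective {x} {y} x≢0 y≢0 χx≡χy = trans (sym (χ-red x x≢0)) (trans (cong π χx≡χy) (χ-red y y≢0))

  χ^-0 : ∀ b → χ^ b 𝔽.0# ≡ 0#
  χ^-0 b with 𝔽.0# 𝔽.≟ 𝔽.0#
  ... | yes _   = refl
  ... | no 0≢0  = ⊥-elim (0≢0 refl)

  χ^-≢0 : ∀ b {x} → x ≢ 𝔽.0# → χ^ b x ≡ χ x ^ (b %ℕ K)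
  χ^-≢0 b {x} x≢0 with x 𝔽.≟ 𝔽.0#
  ... | yes x≡0 = ⊥-elim (x≢0 x≡0)
  ... | no  _   = pow≡^ (χ x) (b %ℕ K)

  χ^-ℕ : ∀ n {x} → x ≢ 𝔽.0# → χ^ (ℤ.+ n) x ≡ χ x ^ n
  χ^-ℕ n {x} x≢0 = begin
    χ^ (ℤ.+ n) x                          ≡⟨ χ^-≢0 (ℤ.+ n) x≢0 ⟩
    χ x ^ (n ℕ.% K)                       ≡⟨ sym (^-+-*K (χᴷ≡1 x≢0) (n ℕ.% K) (n ℕ./ K)) ⟩
    χ x ^ (n ℕ.% K ℕ.+ (n ℕ./ K) ℕ.* K)    ≡⟨ cong (χ x ^_) (sym (ℕ.m≡m%n+[m/n]*n n K)) ⟩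
    χ x ^ n                               ∎

  χ^-+ : ∀ b c x → χ^ (b ℤ.+ c) x ≡ χ^ b x * χ^ c x
  χ^-+ b c = 𝔽.case-0-≢0 (begin
    χ^ (b ℤ.+ c) 𝔽.0#          ≡⟨ χ^-0 (b ℤ.+ c) ⟩
    0#                         ≡⟨ sym (zeroˡ _) ⟩
    0# * χ^ c 𝔽.0#             ≡⟨ cong (_* χ^ c 𝔽.0#) (sym (χ^-0 b)) ⟩
    χ^ b 𝔽.0# * χ^ c 𝔽.0#      ∎) χ^-+-≢0
    where
    χ^-+-≢0 : ∀ {x} → x ≢ 𝔽.0# → χ^ (b ℤ.+ c) x ≡ χ^ b x * χ^ c x
    χ^-+-≢0 {x} x≢0 = begin
      χ^ (b ℤ.+ c) x                              ≡⟨ χ^-≢0 (b ℤ.+ c) x≢0 ⟩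
      χ x ^ ((b ℤ.+ c) %ℕ K)                      ≡⟨ sym (^-periodic (χᴷ≡1 x≢0) q residues-add) ⟩
      χ x ^ (b %ℕ K ℕ.+ c %ℕ K)                   ≡⟨ ^-homo-* (χ x) (b %ℕ K) (c %ℕ K) ⟩
      χ x ^ (b %ℕ K) * χ x ^ (c %ℕ K)             ≡⟨ sym (cong₂ _*_ (χ^-≢0 b x≢0) (χ^-≢0 c x≢0)) ⟩
      χ^ b x * χ^ c x                             ∎
      where
      q = (b ℤ.+ c) /ℕ K ℤ.- b /ℕ K ℤ.- c /ℕ K
      residues-add : ℤ.+ (b %ℕ K ℕ.+ c %ℕ K) ≡ ℤ.+ ((b ℤ.+ c) %ℕ K) ℤ.+ q ℤ.* ℤ.+ K
      residues-add = trans (ℤ.pos-+ (b %ℕ K) (c %ℕ K))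
        (congruence-+ {x = ℤ.+ (b %ℕ K)} {ℤ.+ (c %ℕ K)} {ℤ.+ ((b ℤ.+ c) %ℕ K)} {b /ℕ K} {c /ℕ K} {(b ℤ.+ c) /ℕ K} {ℤ.+ K}
          (ℤ.a≡a%ℕn+[a/ℕn]*n b K) (ℤ.a≡a%ℕn+[a/ℕn]*n c K) (ℤ.a≡a%ℕn+[a/ℕn]*n (b ℤ.+ c) K))

  χ^-* : ∀ b x y → χ^ b (x 𝔽.* y) ≡ χ^ b x * χ^ b y
  χ^-* b = 𝔽.case-0-≢0 x≡0 (λ x≢0 → 𝔽.case-0-≢0 (y≡0 _) (χ^-*-≢0 x≢0))
    where
    x≡0 : ∀ y → χ^ b (𝔽.0# 𝔽.* y) ≡ χ^ b 𝔽.0# * χ^ b y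
    x≡0 y = begin
      χ^ b (𝔽.0# 𝔽.* y)       ≡⟨ cong (χ^ b) (𝔽.zeroˡ y) ⟩
      χ^ b 𝔽.0#               ≡⟨ χ^-0 b ⟩
      0#                      ≡⟨ sym (zeroˡ _) ⟩
      0# * χ^ b y             ≡⟨ cong (_* χ^ b y) (sym (χ^-0 b)) ⟩
      χ^ b 𝔽.0# * χ^ b y      ∎
    y≡0 : ∀ x → χ^ b (x 𝔽.* 𝔽.0#) ≡ χ^ b x * χ^ b 𝔽.0#
    y≡0 x = begin
      χ^ b (x 𝔽.* 𝔽.0#)       ≡⟨ cong (χ^ b) (𝔽.zeroʳ x) ⟩
      χ^ b 𝔽.0#               ≡⟨ χ^-0 b ⟩
      0#                      ≡⟨ sym (zeroʳ _) ⟩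
      χ^ b x * 0#             ≡⟨ cong (χ^ b x *_) (sym (χ^-0 b)) ⟩
      χ^ b x * χ^ b 𝔽.0#      ∎
    χ^-*-≢0 : ∀ {x y} → x ≢ 𝔽.0# → y ≢ 𝔽.0# → χ^ b (x 𝔽.* y) ≡ χ^ b x * χ^ b y
    χ^-*-≢0 {x} {y} x≢0 y≢0 = begin
      χ^ b (x 𝔽.* y)                        ≡⟨ χ^-≢0 b (𝔽.*-≢0 x≢0 y≢0) ⟩
      χ (x 𝔽.* y) ^ (b %ℕ K)                ≡⟨ cong (_^ (b %ℕ K)) (χ-* x≢0 y≢0) ⟩
      (χ x * χ y) ^ (b %ℕ K)                ≡⟨ ^-distrib-* (χ x) (χ y) (b %ℕ K) ⟩
      χ x ^ (b %ℕ K) * χ y ^ (b %ℕ K)       ≡⟨ sym (cong₂ _*_ (χ^-≢0 b x≢0) (χ^-≢0 b y≢0)) ⟩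
      χ^ b x * χ^ b y                       ∎

  χ^-1 : ∀ b → χ^ b 𝔽.1# ≡ 1#
  χ^-1 b = begin
    χ^ b 𝔽.1#                ≡⟨ χ^-≢0 b 𝔽.1≢0 ⟩
    χ 𝔽.1# ^ (b %ℕ K)        ≡⟨ cong (_^ (b %ℕ K)) χ-1 ⟩
    1# ^ (b %ℕ K)            ≡⟨ 1^n≡1 (b %ℕ K) ⟩
    1#                       ∎

  χ^-ᴷ : ∀ b {x} → x ≢ 𝔽.0# → χ^ b x ^ K ≡ 1#
  χ^-ᴷ b {x} x≢0 = begin
    χ^ b x ^ K                   ≡⟨ cong (_^ K) (χ^-≢0 b x≢0) ⟩
    (χ x ^ (b %ℕ K)) ^ K         ≡⟨ ^-assocʳ (χ x) (b %ℕ K) K ⟩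
    χ x ^ ((b %ℕ K) ℕ.* K)       ≡⟨ ^-*-K≡1 (χᴷ≡1 x≢0) (b %ℕ K) ⟩
    1#                           ∎

  χ^-*K : ∀ t {x} → x ≢ 𝔽.0# → χ^ (ℤ.+ (t ℕ.* K)) x ≡ 1#
  χ^-*K t x≢0 = trans (χ^-ℕ (t ℕ.* K) x≢0) (^-*-K≡1 (χᴷ≡1 x≢0) t)

  χ^-inverseʳ : ∀ b {x} → x ≢ 𝔽.0# → χ^ b x * χ^ (ℤ.- b) x ≡ 1#
  χ^-inverseʳ b {x} x≢0 = begin
    χ^ b x * χ^ (ℤ.- b) x     ≡⟨ sym (χ^-+ b (ℤ.- b) x) ⟩
    χ^ (b ℤ.- b) x            ≡⟨ cong (λ e → χ^ e x) (ℤ.+-inverseʳ b) ⟩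
    χ^ (ℤ.+ 0) x              ≡⟨ χ^-ℕ 0 x≢0 ⟩
    1#                        ∎

  χ^-neg-ℕ : ∀ n {x} → x ≢ 𝔽.0# → χ^ (ℤ.- ℤ.+ n) x ≡ χ^ ℤ.-1ℤ x ^ n
  χ^-neg-ℕ zero    x≢0 = χ^-ℕ 0 x≢0
  χ^-neg-ℕ (suc n) {x} x≢0 = begin
    χ^ (ℤ.- ℤ.+ suc n) x                       ≡⟨ cong (λ e → χ^ e x) (ℤ.neg-distrib-+ (ℤ.+ 1) (ℤ.+ n)) ⟩
    χ^ (ℤ.-1ℤ ℤ.+ ℤ.- ℤ.+ n) x                 ≡⟨ χ^-+ ℤ.-1ℤ (ℤ.- ℤ.+ n) x ⟩
    χ^ ℤ.-1ℤ x * χ^ (ℤ.- ℤ.+ n) x              ≡⟨ cong (χ^ ℤ.-1ℤ x *_) (χ^-neg-ℕ n x≢0) ⟩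
    χ^ ℤ.-1ℤ x * χ^ ℤ.-1ℤ x ^ n                ∎

  χ^-‿inverse : ∀ b {x y} → x 𝔽.* y ≡ 𝔽.1# → χ^ (ℤ.- b) y ≡ χ^ b x
  χ^-‿inverse b {x} {y} xy≡1 = begin
    χ^ (ℤ.- b) y                             ≡⟨ sym (*-identityʳ _) ⟩
    χ^ (ℤ.- b) y * 1#                        ≡⟨ cong (χ^ (ℤ.- b) y *_) (sym (trans (cong (χ^ b) xy≡1) (χ^-1 b))) ⟩
    χ^ (ℤ.- b) y * χ^ b (x 𝔽.* y)            ≡⟨ cong (χ^ (ℤ.- b) y *_) (χ^-* b x y) ⟩
    χ^ (ℤ.- b) y * (χ^ b x * χ^ b y)         ≡⟨ *-Solver.solve 3 (λ a b c → (a ⊕ (b ⊕ c)) ⊜ ((c ⊕ a) ⊕ b)) refl _ _ _ ⟩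
    (χ^ b y * χ^ (ℤ.- b) y) * χ^ b x         ≡⟨ cong (_* χ^ b x) (χ^-inverseʳ b (𝔽.x*y≡1⇒y≢0 xy≡1)) ⟩
    1# * χ^ b x                              ≡⟨ *-identityˡ _ ⟩
    χ^ b x                                   ∎
    where open *-Solver using (_⊕_; _⊜_)

  ψ : ℕ → 𝔽.Carrier → 𝔽.Carrier → Carrier
  ψ i x u = χ^ (ℤ.+ i) x * χ^ (ℤ.- ℤ.+ i) u

  orthogonality-≡ : ∀ {u} → u ≢ 𝔽.0# → ∑[ i ∈ upTo K ] ψ i u u ≡ fromℕ K
  orthogonality-≡ {u} u≢0 = begin
    ∑[ i ∈ upTo K ] ψ i u u                             ≡⟨ ∑-cong (λ i → χ^-inverseʳ (ℤ.+ i) u≢0) (upTo K) ⟩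
    ∑[ i ∈ upTo K ] 1#                                  ≡⟨ ∑-const-1 (upTo K) ⟩
    fromℕ (length (upTo K))                             ≡⟨ cong fromℕ (length-upTo K) ⟩
    fromℕ K                                             ∎

  orthogonality-≢ : ∀ {x u} → x ≢ u → ∑[ i ∈ upTo K ] ψ i x u ≡ 0#
  orthogonality-≢ {x} {u} = 𝔽.case-0-≢0 {P = λ x → x ≢ u → S x u ≡ 0#} (λ _ → x≡0)
    (λ x≢0 → 𝔽.case-0-≢0 {P = λ u → _ ≢ u → S _ u ≡ 0#} (λ _ → u≡0 _) (both-≢0 x≢0) u) x
    where
    S : 𝔽.Carrier → 𝔽.Carrier → Carrier
    S x u = ∑[ i ∈ upTo K ] ψ i x u

    x≡0 : ∀ {u} → S 𝔽.0# u ≡ 0#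
    x≡0 {u} = ∑-zero _ (upTo K) (λ i _ → trans (cong (_* χ^ (ℤ.- ℤ.+ i) u) (χ^-0 (ℤ.+ i))) (zeroˡ _))

    u≡0 : ∀ x → S x 𝔽.0# ≡ 0#
    u≡0 x = ∑-zero _ (upTo K) (λ i _ → trans (cong (χ^ (ℤ.+ i) x *_) (χ^-0 (ℤ.- ℤ.+ i))) (zeroʳ _))

    -- The terms are the powers of w = χ(x) χ(u)⁻¹, a K-th root of unity different from 1.
    both-≢0 : ∀ {x u} → x ≢ 𝔽.0# → u ≢ 𝔽.0# → x ≢ u → S x u ≡ 0#
    both-≢0 {x} {u} x≢0 u≢0 x≢u with root-of-unity-dichotomy noZeroDiv w K wᴷ≡1
      where
      w = χ x * χ^ ℤ.-1ℤ u
      wᴷ≡1 : w ^ K ≡ 1#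
      wᴷ≡1 = trans (^-distrib-* (χ x) _ K) (trans (cong₂ _*_ (χᴷ≡1 x≢0) (χ^-ᴷ ℤ.-1ℤ u≢0)) (*-identityˡ 1#))
    ... | inj₂ ∑wⁱ≡0 = trans (∑-cong termᵢ≡wⁱ (upTo K)) ∑wⁱ≡0
      where
      termᵢ≡wⁱ : ∀ i → ψ i x u ≡ (χ x * χ^ ℤ.-1ℤ u) ^ i
      termᵢ≡wⁱ i = trans (cong₂ _*_ (χ^-ℕ i x≢0) (χ^-neg-ℕ i u≢0)) (sym (^-distrib-* (χ x) _ i))
    ... | inj₁ w≡1 = ⊥-elim (x≢u (χ-injective x≢0 u≢0 (begin
      χ x                                   ≡⟨ sym (*-identityʳ (χ x)) ⟩
      χ x * 1#                              ≡⟨ cong (χ x *_) (sym (trans (*-comm _ _) (χ^-inverseʳ (ℤ.+ 1) u≢0))) ⟩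
      χ x * (χ^ ℤ.-1ℤ u * χ^ (ℤ.+ 1) u)     ≡⟨ sym (*-assoc _ _ _) ⟩
      (χ x * χ^ ℤ.-1ℤ u) * χ^ (ℤ.+ 1) u     ≡⟨ cong₂ _*_ w≡1 (χ^-ℕ 1 u≢0) ⟩
      1# * (χ u * 1#)                       ≡⟨ *-identityˡ _ ⟩
      χ u * 1#                              ≡⟨ *-identityʳ (χ u) ⟩
      χ u                                   ∎)))

  x≡-x⇒x≡0 : ∀ {x} → x ≡ - x → x ≡ 0#
  x≡-x⇒x≡0 {x} x≡-x with noZeroDiv (1# + 1#) x 2x≡0
    where
    2x≡0 : (1# + 1#) * x ≡ 0#
    2x≡0 = begin
      (1# + 1#) * x        ≡⟨ distribʳ x 1# 1# ⟩
      1# * x + 1# * x      ≡⟨ cong₂ _+_ (*-identityˡ x) (*-identityˡ x) ⟩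
      x + x                ≡⟨ cong (x +_) x≡-x ⟩
      x + - x              ≡⟨ -‿inverseʳ x ⟩
      0#                   ∎
  ... | inj₁ 1+1≡0 = ⊥-elim (charZero 1 (trans (cong (1# +_) (+-identityʳ 1#)) 1+1≡0))
  ... | inj₂ x≡0   = x≡0

  -- J^(b,c) sums over z₁ + z₂ + 1 = 0, parametrised by z₂ = ν z₁.
  ν : 𝔽.Carrier → 𝔽.Carrier
  ν z = 𝔽.- (𝔽.1# 𝔽.+ z)

  ν-* : ∀ {u w} a → u 𝔽.* w ≡ 𝔽.1# → ν (w 𝔽.* a) ≡ w 𝔽.* 𝔽.- (u 𝔽.+ a)
  ν-* {u} {w} a uw≡1 = begin
    𝔽.- (𝔽.1# 𝔽.+ w 𝔽.* a)            ≡⟨ cong (λ z → 𝔽.- (z 𝔽.+ w 𝔽.* a)) (sym (trans (𝔽.*-comm w u) uw≡1)) ⟩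
    𝔽.- (w 𝔽.* u 𝔽.+ w 𝔽.* a)         ≡⟨ cong 𝔽.-_ (sym (𝔽.distribˡ w u a)) ⟩
    𝔽.- (w 𝔽.* (u 𝔽.+ a))             ≡⟨ 𝔽.-‿distribʳ-* w (u 𝔽.+ a) ⟩
    w 𝔽.* 𝔽.- (u 𝔽.+ a)               ∎

  module Collapse (α : 𝔽.Carrier) (a₁ a₂ : ℕ) where

    A₁ A₂ : ℤ
    A₁ = ℤ.+ a₁
    A₂ = ℤ.+ a₂

    weight : 𝔽.Carrier → 𝔽.Carrier → Carrier
    weight x y = χ^ A₂ α * (χ^ A₁ x * χ^ A₂ (ν x)) * χ^ A₂ (ν y)

    E : 𝔽.Carrier → Carrier
    E y = weight (α 𝔽.* y) y

    term : ℕ → Carrier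
    term i = χ^ (A₂ ℤ.- ℤ.+ i) α * J (A₁ ℤ.+ ℤ.+ i) A₂ * J (ℤ.- ℤ.+ i) A₂

    term-factor : ∀ i x y →
      (χ^ (A₂ ℤ.- ℤ.+ i) α * (χ^ (A₁ ℤ.+ ℤ.+ i) x * χ^ A₂ (ν x))) * (χ^ (ℤ.- ℤ.+ i) y * χ^ A₂ (ν y))
        ≡ weight x y * ψ i x (α 𝔽.* y)
    term-factor i x y = begin
      (χ^ (A₂ ℤ.- ℤ.+ i) α * (χ^ (A₁ ℤ.+ ℤ.+ i) x * χ^ A₂ (ν x))) * (χ^ (ℤ.- ℤ.+ i) y * χ^ A₂ (ν y))
        ≡⟨ cong₂ (λ a b → (a * (b * χ^ A₂ (ν x))) * (χ^ (ℤ.- ℤ.+ i) y * χ^ A₂ (ν y)))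
                 (χ^-+ A₂ (ℤ.- ℤ.+ i) α) (χ^-+ A₁ (ℤ.+ i) x) ⟩
      ((a₂α * a⁻ⁱα) * ((a₁x * aⁱx) * νx)) * (a⁻ⁱy * νy)
        ≡⟨ *-Solver.solve 7 (λ a₂α a⁻ⁱα a₁x aⁱx νx a⁻ⁱy νy →
             (((a₂α ⊕ a⁻ⁱα) ⊕ ((a₁x ⊕ aⁱx) ⊕ νx)) ⊕ (a⁻ⁱy ⊕ νy)) ⊜ (((a₂α ⊕ (a₁x ⊕ νx)) ⊕ νy) ⊕ (aⁱx ⊕ (a⁻ⁱα ⊕ a⁻ⁱy))))
             refl a₂α a⁻ⁱα a₁x aⁱx νx a⁻ⁱy νy ⟩
      weight x y * (aⁱx * (a⁻ⁱα * a⁻ⁱy))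
        ≡⟨ cong (λ z → weight x y * (aⁱx * z)) (sym (χ^-* (ℤ.- ℤ.+ i) α y)) ⟩
      weight x y * ψ i x (α 𝔽.* y) ∎
      where
      open *-Solver using (_⊕_; _⊜_)
      a₂α = χ^ A₂ α
      a⁻ⁱα = χ^ (ℤ.- ℤ.+ i) α
      a₁x = χ^ A₁ x
      aⁱx = χ^ (ℤ.+ i) x
      νx = χ^ A₂ (ν x)
      a⁻ⁱy = χ^ (ℤ.- ℤ.+ i) y
      νy = χ^ A₂ (ν y)

    term-expand : ∀ i → term i ≡ ∑[ x ∈ 𝔽.elems ] ∑[ y ∈ 𝔽.elems ] (weight x y * ψ i x (α 𝔽.* y))
    term-expand i = begin
      e * - ∑ 𝔽.elems f * - ∑ 𝔽.elems g            ≡⟨ cong (_* - ∑ 𝔽.elems g) (sym (-‿distribʳ-* e _)) ⟩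
      - (e * ∑ 𝔽.elems f) * - ∑ 𝔽.elems g          ≡⟨ -x*-y≡x*y (e * ∑ 𝔽.elems f) (∑ 𝔽.elems g) ⟩
      (e * ∑ 𝔽.elems f) * ∑ 𝔽.elems g              ≡⟨ cong (_* ∑ 𝔽.elems g) (*-distribˡ-∑ e f 𝔽.elems) ⟩
      ∑[ x ∈ 𝔽.elems ] (e * f x) * ∑ 𝔽.elems g     ≡⟨ *-distribʳ-∑ (∑ 𝔽.elems g) (λ x → e * f x) 𝔽.elems ⟩
      ∑[ x ∈ 𝔽.elems ] (e * f x * ∑ 𝔽.elems g)     ≡⟨ ∑-cong (λ x → *-distribˡ-∑ (e * f x) g 𝔽.elems) 𝔽.elems ⟩
      ∑[ x ∈ 𝔽.elems ] ∑[ y ∈ 𝔽.elems ] (e * f x * g y)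
        ≡⟨ ∑-cong (λ x → ∑-cong (term-factor i x) 𝔽.elems) 𝔽.elems ⟩
      ∑[ x ∈ 𝔽.elems ] ∑[ y ∈ 𝔽.elems ] (weight x y * ψ i x (α 𝔽.* y)) ∎
      where
      e = χ^ (A₂ ℤ.- ℤ.+ i) α
      f g : 𝔽.Carrier → Carrier
      f x = χ^ (A₁ ℤ.+ ℤ.+ i) x * χ^ A₂ (ν x)
      g y = χ^ (ℤ.- ℤ.+ i) y * χ^ A₂ (ν y)

    weight-0ˡ : ∀ y → weight 𝔽.0# y ≡ 0#
    weight-0ˡ y = begin
      χ^ A₂ α * (χ^ A₁ 𝔽.0# * χ^ A₂ (ν 𝔽.0#)) * χ^ A₂ (ν y)   ≡⟨ cong (λ z → χ^ A₂ α * (z * χ^ A₂ (ν 𝔽.0#)) * χ^ A₂ (ν y)) (χ^-0 A₁) ⟩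
      χ^ A₂ α * (0# * χ^ A₂ (ν 𝔽.0#)) * χ^ A₂ (ν y)           ≡⟨ cong (λ z → χ^ A₂ α * z * χ^ A₂ (ν y)) (zeroˡ _) ⟩
      χ^ A₂ α * 0# * χ^ A₂ (ν y)                              ≡⟨ cong (_* χ^ A₂ (ν y)) (zeroʳ _) ⟩
      0# * χ^ A₂ (ν y)                                        ≡⟨ zeroˡ _ ⟩
      0#                                                      ∎

    diagonal : ∀ y → weight (α 𝔽.* y) y * ∑[ i ∈ upTo K ] ψ i (α 𝔽.* y) (α 𝔽.* y) ≡ fromℕ K * E y
    diagonal y = 𝔽.case-0-≢0 {P = λ u → weight u y * ∑[ i ∈ upTo K ] ψ i u u ≡ fromℕ K * weight u y}
      (trans (cong (_* ∑[ i ∈ upTo K ] ψ i 𝔽.0# 𝔽.0#) (weight-0ˡ y)) (trans (zeroˡ _) (sym (trans (cong (fromℕ K *_) (weight-0ˡ y)) (zeroʳ _)))))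
      (λ u≢0 → trans (cong (weight _ y *_) (orthogonality-≡ u≢0)) (*-comm _ _))
      (α 𝔽.* y)

    c₁-sum≡K*∑E : c₁-sum α a₁ a₂ a₂ ≡ fromℕ K * ∑ 𝔽.elems E
    c₁-sum≡K*∑E = begin
      ∑ (upTo K) term
        ≡⟨ ∑-cong term-expand (upTo K) ⟩
      ∑[ i ∈ upTo K ] ∑[ x ∈ 𝔽.elems ] ∑[ y ∈ 𝔽.elems ] (weight x y * ψ i x (α 𝔽.* y))
        ≡⟨ ∑-comm _ (upTo K) 𝔽.elems ⟩
      ∑[ x ∈ 𝔽.elems ] ∑[ i ∈ upTo K ] ∑[ y ∈ 𝔽.elems ] (weight x y * ψ i x (α 𝔽.* y))
        ≡⟨ ∑-cong (λ x → ∑-comm _ (upTo K) 𝔽.elems) 𝔽.elems ⟩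
      ∑[ x ∈ 𝔽.elems ] ∑[ y ∈ 𝔽.elems ] ∑[ i ∈ upTo K ] (weight x y * ψ i x (α 𝔽.* y))
        ≡⟨ ∑-cong (λ x → ∑-cong (λ y → sym (*-distribˡ-∑ (weight x y) _ (upTo K))) 𝔽.elems) 𝔽.elems ⟩
      ∑[ x ∈ 𝔽.elems ] ∑[ y ∈ 𝔽.elems ] (weight x y * ∑[ i ∈ upTo K ] ψ i x (α 𝔽.* y))
        ≡⟨ ∑-comm _ 𝔽.elems 𝔽.elems ⟩
      ∑[ y ∈ 𝔽.elems ] ∑[ x ∈ 𝔽.elems ] (weight x y * ∑[ i ∈ upTo K ] ψ i x (α 𝔽.* y))
        ≡⟨ ∑-cong (λ y → ∑-point _ (α 𝔽.* y) (λ x x≢αy → trans (cong (weight x y *_) (orthogonality-≢ x≢αy)) (zeroʳ _))) 𝔽.elems ⟩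
      ∑[ y ∈ 𝔽.elems ] (weight (α 𝔽.* y) y * ∑[ i ∈ upTo K ] ψ i (α 𝔽.* y) (α 𝔽.* y))
        ≡⟨ ∑-cong diagonal 𝔽.elems ⟩
      ∑[ y ∈ 𝔽.elems ] (fromℕ K * E y)
        ≡⟨ sym (*-distribˡ-∑ (fromℕ K) E 𝔽.elems) ⟩
      fromℕ K * ∑ 𝔽.elems E ∎

  module Involution (α : 𝔽.Carrier) (α≢0 : α ≢ 𝔽.0#) (a₁ a₂ t : ℕ) (2a≡tK : 2 ℕ.* (a₁ ℕ.+ a₂) ≡ t ℕ.* K)
                    (χ^a₁+a₂[α]≡-1 : χ^ (ℤ.+ a₁ ℤ.+ ℤ.+ a₂) α ≡ - 1#) where

    open Collapse α a₁ a₂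

    σ : 𝔽.Carrier → 𝔽.Carrier
    σ y = (α 𝔽.* y) 𝔽.⁻¹

    σ0≡0 : σ 𝔽.0# ≡ 𝔽.0#
    σ0≡0 = trans (cong 𝔽._⁻¹ (𝔽.zeroʳ α)) 𝔽.0⁻¹≡0

    σ-involutive : ∀ y → σ (σ y) ≡ y
    σ-involutive = 𝔽.case-0-≢0 σσ0≡0 σσ≡id
      where
      σσ0≡0 : σ (σ 𝔽.0#) ≡ 𝔽.0#
      σσ0≡0 = trans (cong σ σ0≡0) σ0≡0
      σσ≡id : ∀ {y} → y ≢ 𝔽.0# → σ (σ y) ≡ y
      σσ≡id {y} y≢0 = 𝔽.⁻¹-unique _ y (begin
        (α 𝔽.* (α 𝔽.* y) 𝔽.⁻¹) 𝔽.* y   ≡⟨ 𝔽.*-Solver.solve 3 (λ a v y → ((a ⊕ v) ⊕ y) ⊜ ((a ⊕ y) ⊕ v)) refl α ((α 𝔽.* y) 𝔽.⁻¹) y ⟩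
        (α 𝔽.* y) 𝔽.* (α 𝔽.* y) 𝔽.⁻¹   ≡⟨ 𝔽.x*x⁻¹≡1 (𝔽.*-≢0 α≢0 y≢0) ⟩
        𝔽.1#                            ∎)
        where open 𝔽.*-Solver using (_⊕_; _⊜_)

    a₁+2a₂≡-a₁+tK : ℤ.+ a₁ ℤ.+ ℤ.+ a₂ ℤ.+ ℤ.+ a₂ ≡ ℤ.- ℤ.+ a₁ ℤ.+ ℤ.+ (t ℕ.* K)
    a₁+2a₂≡-a₁+tK = begin
      A₁ ℤ.+ A₂ ℤ.+ A₂                        ≡⟨ x+y+y≡-x+[[x+y]+[x+y]] A₁ A₂ ⟩
      ℤ.- A₁ ℤ.+ ((A₁ ℤ.+ A₂) ℤ.+ (A₁ ℤ.+ A₂))  ≡⟨ cong (λ z → ℤ.- A₁ ℤ.+ z) 2a≡tK′ ⟩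
      ℤ.- A₁ ℤ.+ ℤ.+ (t ℕ.* K)                ∎
      where
      2a≡tK′ : (A₁ ℤ.+ A₂) ℤ.+ (A₁ ℤ.+ A₂) ≡ ℤ.+ (t ℕ.* K)
      2a≡tK′ = begin
        (A₁ ℤ.+ A₂) ℤ.+ (A₁ ℤ.+ A₂)                   ≡⟨ sym (cong₂ ℤ._+_ (ℤ.pos-+ a₁ a₂) (ℤ.pos-+ a₁ a₂)) ⟩
        ℤ.+ (a₁ ℕ.+ a₂) ℤ.+ ℤ.+ (a₁ ℕ.+ a₂)          ≡⟨ sym (ℤ.pos-+ (a₁ ℕ.+ a₂) (a₁ ℕ.+ a₂)) ⟩
        ℤ.+ ((a₁ ℕ.+ a₂) ℕ.+ (a₁ ℕ.+ a₂))            ≡⟨ cong (λ m → ℤ.+ ((a₁ ℕ.+ a₂) ℕ.+ m)) (sym (ℕ.+-identityʳ (a₁ ℕ.+ a₂))) ⟩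
        ℤ.+ (2 ℕ.* (a₁ ℕ.+ a₂))                      ≡⟨ cong ℤ.+_ 2a≡tK ⟩
        ℤ.+ (t ℕ.* K)                                ∎

    χ^a₁[w]χ^a₂[w]²≡χ^a₁[u] : ∀ {u w} → u 𝔽.* w ≡ 𝔽.1# → χ^ A₁ w * χ^ A₂ w * χ^ A₂ w ≡ χ^ A₁ u
    χ^a₁[w]χ^a₂[w]²≡χ^a₁[u] {u} {w} uw≡1 = begin
      χ^ A₁ w * χ^ A₂ w * χ^ A₂ w               ≡⟨ cong (_* χ^ A₂ w) (sym (χ^-+ A₁ A₂ w)) ⟩
      χ^ (A₁ ℤ.+ A₂) w * χ^ A₂ w                ≡⟨ sym (χ^-+ (A₁ ℤ.+ A₂) A₂ w) ⟩
      χ^ (A₁ ℤ.+ A₂ ℤ.+ A₂) w                   ≡⟨ cong (λ b → χ^ b w) a₁+2a₂≡-a₁+tK ⟩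
      χ^ (ℤ.- A₁ ℤ.+ ℤ.+ (t ℕ.* K)) w           ≡⟨ χ^-+ (ℤ.- A₁) (ℤ.+ (t ℕ.* K)) w ⟩
      χ^ (ℤ.- A₁) w * χ^ (ℤ.+ (t ℕ.* K)) w      ≡⟨ cong (χ^ (ℤ.- A₁) w *_) (χ^-*K t (𝔽.x*y≡1⇒y≢0 uw≡1)) ⟩
      χ^ (ℤ.- A₁) w * 1#                        ≡⟨ *-identityʳ _ ⟩
      χ^ (ℤ.- A₁) w                             ≡⟨ χ^-‿inverse A₁ uw≡1 ⟩
      χ^ A₁ u                                   ∎

    E∘σ≡-E-≢0 : ∀ {y} → y ≢ 𝔽.0# → E (σ y) ≡ - E y
    E∘σ≡-E-≢0 {y} y≢0 = begin
      a₂α * (χ^ A₁ (α 𝔽.* w) * χ^ A₂ (ν (α 𝔽.* w))) * χ^ A₂ (ν w)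
        ≡⟨ cong₂ (λ p r → a₂α * (χ^ A₁ (α 𝔽.* w) * p) * r) χ^a₂[ν[αw]] χ^a₂[νw] ⟩
      a₂α * (χ^ A₁ (α 𝔽.* w) * (a₂w * (a₂α * νy))) * (a₂w * νu)
        ≡⟨ cong (λ p → a₂α * (p * (a₂w * (a₂α * νy))) * (a₂w * νu)) (χ^-* A₁ α w) ⟩
      a₂α * ((a₁α * a₁w) * (a₂w * (a₂α * νy))) * (a₂w * νu)
        ≡⟨ *-Solver.solve 6 (λ a₂α a₁α a₁w a₂w νy νu →
             ((a₂α ⊕ ((a₁α ⊕ a₁w) ⊕ (a₂w ⊕ (a₂α ⊕ νy)))) ⊕ (a₂w ⊕ νu))
             ⊜ ((a₁α ⊕ a₂α) ⊕ (((a₁w ⊕ a₂w) ⊕ a₂w) ⊕ ((a₂α ⊕ νu) ⊕ νy))))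
             refl a₂α a₁α a₁w a₂w νy νu ⟩
      (a₁α * a₂α) * ((a₁w * a₂w * a₂w) * ((a₂α * νu) * νy))
        ≡⟨ cong₂ (λ p r → p * (r * ((a₂α * νu) * νy))) (trans (sym (χ^-+ A₁ A₂ α)) χ^a₁+a₂[α]≡-1) (χ^a₁[w]χ^a₂[w]²≡χ^a₁[u] uw≡1) ⟩
      - 1# * (χ^ A₁ u * ((a₂α * νu) * νy))
        ≡⟨ -1*x≈-x _ ⟩
      - (χ^ A₁ u * ((a₂α * νu) * νy))
        ≡⟨ cong -_ (*-Solver.solve 4 (λ a b c d → (a ⊕ ((b ⊕ c) ⊕ d)) ⊜ ((b ⊕ (a ⊕ c)) ⊕ d)) refl (χ^ A₁ u) a₂α νu νy) ⟩
      - E y ∎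
      where
      open *-Solver using (_⊕_; _⊜_)
      u = α 𝔽.* y
      w = u 𝔽.⁻¹
      uw≡1 : u 𝔽.* w ≡ 𝔽.1#
      uw≡1 = 𝔽.x*x⁻¹≡1 (𝔽.*-≢0 α≢0 y≢0)
      a₂α = χ^ A₂ α
      a₁α = χ^ A₁ α
      a₁w = χ^ A₁ w
      a₂w = χ^ A₂ w
      νy = χ^ A₂ (ν y)
      νu = χ^ A₂ (ν u)
      ν[αw]≡w[ανy] : ν (α 𝔽.* w) ≡ w 𝔽.* (α 𝔽.* ν y)
      ν[αw]≡w[ανy] = begin
        ν (α 𝔽.* w)                          ≡⟨ cong ν (𝔽.*-comm α w) ⟩
        ν (w 𝔽.* α)                          ≡⟨ ν-* α uw≡1 ⟩
        w 𝔽.* 𝔽.- (α 𝔽.* y 𝔽.+ α)            ≡⟨ cong (λ z → w 𝔽.* 𝔽.- (α 𝔽.* y 𝔽.+ z)) (sym (𝔽.*-identityʳ α)) ⟩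
        w 𝔽.* 𝔽.- (α 𝔽.* y 𝔽.+ α 𝔽.* 𝔽.1#)   ≡⟨ cong (λ z → w 𝔽.* 𝔽.- z) (sym (𝔽.distribˡ α y 𝔽.1#)) ⟩
        w 𝔽.* 𝔽.- (α 𝔽.* (y 𝔽.+ 𝔽.1#))       ≡⟨ cong (λ z → w 𝔽.* 𝔽.- (α 𝔽.* z)) (𝔽.+-comm y 𝔽.1#) ⟩
        w 𝔽.* 𝔽.- (α 𝔽.* (𝔽.1# 𝔽.+ y))       ≡⟨ cong (w 𝔽.*_) (𝔽.-‿distribʳ-* α (𝔽.1# 𝔽.+ y)) ⟩
        w 𝔽.* (α 𝔽.* ν y)                    ∎
      νw≡wνu : ν w ≡ w 𝔽.* ν u
      νw≡wνu = begin
        ν w                         ≡⟨ cong ν (sym (𝔽.*-identityʳ w)) ⟩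
        ν (w 𝔽.* 𝔽.1#)              ≡⟨ ν-* 𝔽.1# uw≡1 ⟩
        w 𝔽.* 𝔽.- (u 𝔽.+ 𝔽.1#)      ≡⟨ cong (λ z → w 𝔽.* 𝔽.- z) (𝔽.+-comm u 𝔽.1#) ⟩
        w 𝔽.* ν u                   ∎
      χ^a₂[ν[αw]] : χ^ A₂ (ν (α 𝔽.* w)) ≡ a₂w * (a₂α * νy)
      χ^a₂[ν[αw]] = trans (cong (χ^ A₂) ν[αw]≡w[ανy]) (trans (χ^-* A₂ w _) (cong (a₂w *_) (χ^-* A₂ α (ν y))))
      χ^a₂[νw] : χ^ A₂ (ν w) ≡ a₂w * νu
      χ^a₂[νw] = trans (cong (χ^ A₂) νw≡wνu) (χ^-* A₂ w (ν u))

    E∘σ≡-E : ∀ y → E (σ y) ≡ - E y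
    E∘σ≡-E = 𝔽.case-0-≢0 (begin
      E (σ 𝔽.0#)     ≡⟨ cong E σ0≡0 ⟩
      E 𝔽.0#         ≡⟨ E0≡0 ⟩
      0#             ≡⟨ sym ε⁻¹≈ε ⟩
      - 0#           ≡⟨ cong -_ (sym E0≡0) ⟩
      - E 𝔽.0#       ∎) E∘σ≡-E-≢0
      where
      E0≡0 : E 𝔽.0# ≡ 0#
      E0≡0 = trans (cong (λ z → weight z 𝔽.0#) (𝔽.zeroʳ α)) (weight-0ˡ 𝔽.0#)

    ∑E≡0 : ∑ 𝔽.elems E ≡ 0#
    ∑E≡0 = x≡-x⇒x≡0 (begin
      ∑ 𝔽.elems E                  ≡⟨ sym (∑-reindex σ σ σ-involutive σ-involutive E) ⟩
      ∑[ y ∈ 𝔽.elems ] E (σ y)     ≡⟨ ∑-cong E∘σ≡-E 𝔽.elems ⟩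
      ∑[ y ∈ 𝔽.elems ] (- E y)     ≡⟨ sym (-‿distrib-∑ E 𝔽.elems) ⟩
      - ∑ 𝔽.elems E                ∎)

  χ^half≡-1 : ∀ {α} r → α ≢ 𝔽.0# → K ≡ r ℕ.+ r → α 𝔽.^ r ≡ 𝔽.- 𝔽.1# → χ α ^ r ≡ - 1#
  χ^half≡-1 {α} r α≢0 K≡2r αʳ≡-1 with x*x≡1⇒x≡1⊎x≡-1 noZeroDiv (χ α ^ r) square≡1
    where
    square≡1 : χ α ^ r * χ α ^ r ≡ 1#
    square≡1 = trans (sym (^-homo-* (χ α) r r)) (trans (cong (χ α ^_) (sym K≡2r)) (χᴷ≡1 α≢0))
  ... | inj₂ χαʳ≡-1 = χαʳ≡-1
  ... | inj₁ χαʳ≡1  = ⊥-elim (𝔽.1+1≢0 r (cong suc K≡2r) (begin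
    𝔽.1# 𝔽.+ 𝔽.1#               ≡⟨ cong (𝔽.1# 𝔽.+_) (sym (trans (cong π χαʳ≡1) π-1)) ⟩
    𝔽.1# 𝔽.+ π (χ α ^ r)        ≡⟨ cong (𝔽.1# 𝔽.+_) (trans (π-^ (χ α) r) (cong (𝔽._^ r) (χ-red α α≢0))) ⟩
    𝔽.1# 𝔽.+ α 𝔽.^ r            ≡⟨ cong (𝔽.1# 𝔽.+_) αʳ≡-1 ⟩
    𝔽.1# 𝔽.+ 𝔽.- 𝔽.1#           ≡⟨ 𝔽.-‿inverseʳ 𝔽.1# ⟩
    𝔽.0#                        ∎))

  c₁≡0 : ∀ {α} → α ≢ 𝔽.0# → ∀ r → K ≡ r ℕ.+ r → α 𝔽.^ r ≡ 𝔽.- 𝔽.1# →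
         ∀ a₁ a₂ t s → 2 ℕ.* (a₁ ℕ.+ a₂) ≡ t ℕ.* K → a₁ ℕ.+ a₂ ≡ suc (s ℕ.+ s) ℕ.* r →
         ∀ c → Isc₁ α a₁ a₂ a₂ c → c ≡ 0#
  c₁≡0 {α} α≢0 r K≡2r αʳ≡-1 a₁ a₂ t s 2a≡tK a≡[2s+1]r c Kc≡±c₁-sum
    with noZeroDiv (fromℕ K) c Kc≡0
    where
    χ^a₁+a₂[α]≡-1 : χ^ (ℤ.+ a₁ ℤ.+ ℤ.+ a₂) α ≡ - 1#
    χ^a₁+a₂[α]≡-1 = begin
      χ^ (ℤ.+ a₁ ℤ.+ ℤ.+ a₂) α           ≡⟨ cong (λ b → χ^ b α) (sym (ℤ.pos-+ a₁ a₂)) ⟩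
      χ^ (ℤ.+ (a₁ ℕ.+ a₂)) α             ≡⟨ χ^-ℕ (a₁ ℕ.+ a₂) α≢0 ⟩
      χ α ^ (a₁ ℕ.+ a₂)                  ≡⟨ cong (χ α ^_) (trans a≡[2s+1]r (ℕ.*-comm (suc (s ℕ.+ s)) r)) ⟩
      χ α ^ (r ℕ.* suc (s ℕ.+ s))        ≡⟨ sym (^-assocʳ (χ α) r (suc (s ℕ.+ s))) ⟩
      (χ α ^ r) ^ suc (s ℕ.+ s)          ≡⟨ cong (_^ suc (s ℕ.+ s)) (χ^half≡-1 r α≢0 K≡2r αʳ≡-1) ⟩
      (- 1#) ^ suc (s ℕ.+ s)             ≡⟨ -1^odd≡-1 s ⟩
      - 1#                               ∎
    c₁-sum≡0 : c₁-sum α a₁ a₂ a₂ ≡ 0#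
    c₁-sum≡0 = begin
      c₁-sum α a₁ a₂ a₂                          ≡⟨ Collapse.c₁-sum≡K*∑E α a₁ a₂ ⟩
      fromℕ K * ∑ 𝔽.elems (Collapse.E α a₁ a₂)   ≡⟨ cong (fromℕ K *_) (Involution.∑E≡0 α α≢0 a₁ a₂ t 2a≡tK χ^a₁+a₂[α]≡-1) ⟩
      fromℕ K * 0#                               ≡⟨ zeroʳ _ ⟩
      0#                                         ∎
    Kc≡0 : fromℕ K * c ≡ 0#
    Kc≡0 = trans Kc≡±c₁-sum (trans (cong (_ *_) c₁-sum≡0) (zeroʳ _))
  ... | inj₁ K≡0 = ⊥-elim (charZero k K≡0)
  ... | inj₂ c≡0 = c≡0

parity : ∀ n → (∃ λ r → n ≡ r ℕ.+ r) ⊎ (∃ λ r → n ≡ suc (r ℕ.+ r))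
parity zero    = inj₁ (0 , refl)
parity (suc n) with parity n
... | inj₁ (r , n≡2r)   = inj₂ (r , cong suc n≡2r)
... | inj₂ (r , n≡2r+1) = inj₁ (suc r , trans (cong suc n≡2r+1) (cong suc (sym (ℕ.+-suc r r))))

[m+m]/2≡m : ∀ m → (m ℕ.+ m) ℕ./ 2 ≡ m
[m+m]/2≡m m = trans (cong (ℕ._/ 2) m+m≡m*2) (ℕ.m*n/n≡m m 2)
  where
  m+m≡m*2 : m ℕ.+ m ≡ m ℕ.* 2
  m+m≡m*2 = ℕ-Solver.solve (m ∷ [])

odd⇒≡2r+1 : ∀ m → ¬ (2 ∣ m) → ∃ λ r → m ≡ suc (r ℕ.+ r)
odd⇒≡2r+1 m 2∤m with parity m
... | inj₂ m≡2r+1     = m≡2r+1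
... | inj₁ (r , m≡2r) = ⊥-elim (2∤m (divides r (trans m≡2r (ℕ-Solver.solve (r ∷ [])))))

odd-multiple : ∀ {m} r t → m ≡ t ℕ.* r → 0 ℕ.< m → m ℕ.< (r ℕ.+ r) ℕ.+ (r ℕ.+ r) → m ≢ r ℕ.+ r →
               ∃ λ s → m ≡ suc (s ℕ.+ s) ℕ.* r
odd-multiple {m} r t m≡tr 0<m m<4r m≢2r with parity t
... | inj₂ (s , t≡2s+1) = s , trans m≡tr (cong (ℕ._* r) t≡2s+1)
... | inj₁ (s , t≡2s)   = ⊥-elim (not-even s (trans m≡tr (trans (cong (ℕ._* r) t≡2s) (ℕ-Solver.solve (s ∷ r ∷ [])))))
  where
  not-even : ∀ s → m ≢ s ℕ.* (r ℕ.+ r)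
  not-even zero          m≡0        = ℕ.<⇒≢ 0<m (sym m≡0)
  not-even (suc zero)    m≡2r       = m≢2r (trans m≡2r (ℕ.+-identityʳ (r ℕ.+ r)))
  not-even (suc (suc s)) m≡[s+2]2r  = ℕ.<⇒≱ m<4r (ℕ.≤-trans (ℕ.m≤m+n ((r ℕ.+ r) ℕ.+ (r ℕ.+ r)) (s ℕ.* (r ℕ.+ r)))
    (ℕ.≤-reflexive (trans 4r+2sr≡[s+2]2r (sym m≡[s+2]2r))))
    where
    4r+2sr≡[s+2]2r : (r ℕ.+ r) ℕ.+ (r ℕ.+ r) ℕ.+ s ℕ.* (r ℕ.+ r) ≡ suc (suc s) ℕ.* (r ℕ.+ r)
    4r+2sr≡[s+2]2r = ℕ-Solver.solve (s ∷ r ∷ [])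

no-field-with-one-element : FiniteField 1 → ⊥
no-field-with-one-element F = FiniteField.0≢1 F (singleton (FiniteField.elems F) (FiniteField.size F)
  (FiniteField.complete F _) (FiniteField.complete F _))
  where
  singleton : ∀ {B : Set} (xs : List B) {x y : B} → length xs ≡ 1 → x ∈ xs → y ∈ xs → x ≡ y
  singleton (_ ∷ []) _ (here x≡z) (here y≡z) = trans x≡z (sym y≡z)

exponent-sum-odd : ∀ {K r n t} n₁ n₂ .{{_ : ℕ.NonZero n}} → 0 ℕ.< K → K ≡ r ℕ.+ r → n ∣ K →
  0 ℕ.< n₁ → n₁ ℕ.< n → n₂ ℕ.< n →
  2 ℕ.* (n₁ ℕ.* (K ℕ./ n) ℕ.+ n₂ ℕ.* (K ℕ./ n)) ≡ t ℕ.* K → n₁ ℕ.* (K ℕ./ n) ℕ.+ n₂ ℕ.* (K ℕ./ n) ≢ K →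
  ∃ λ s → n₁ ℕ.* (K ℕ./ n) ℕ.+ n₂ ℕ.* (K ℕ./ n) ≡ suc (s ℕ.+ s) ℕ.* r
exponent-sum-odd {K} {r} {n} {t} n₁ n₂ 0<K K≡2r (divides d K≡dn) 0<n₁ n₁<n n₂<n 2a≡tK a≢K =
  odd-multiple r t a≡tr 0<a (subst (a ℕ.<_) (cong₂ ℕ._+_ K≡2r K≡2r) (ℕ.+-mono-< (aᵢ<K n₁<n) (aᵢ<K n₂<n)))
    (λ a≡2r → a≢K (trans a≡2r (sym K≡2r)))
  where
  a = n₁ ℕ.* (K ℕ./ n) ℕ.+ n₂ ℕ.* (K ℕ./ n)

  K/n≡d : K ℕ./ n ≡ d
  K/n≡d = trans (cong (ℕ._/ n) K≡dn) (ℕ.m*n/n≡m d n)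

  0<d : 0 ℕ.< d
  0<d = ℕ.n≢0⇒n>0 (λ d≡0 → ℕ.<⇒≢ 0<K (sym (trans K≡dn (cong (ℕ._* n) d≡0))))

  aᵢ<K : ∀ {nᵢ} → nᵢ ℕ.< n → nᵢ ℕ.* (K ℕ./ n) ℕ.< K
  aᵢ<K {nᵢ} nᵢ<n = subst₂ ℕ._<_ (cong (nᵢ ℕ.*_) (sym K/n≡d)) (trans (ℕ.*-comm n d) (sym K≡dn))
    (ℕ.*-monoˡ-< d {{ℕ.>-nonZero 0<d}} nᵢ<n)

  0<a : 0 ℕ.< a
  0<a = ℕ.<-≤-trans (subst (λ e → 0 ℕ.< n₁ ℕ.* e) (sym K/n≡d) 0<n₁d) (ℕ.m≤m+n _ _)
    where
    0<n₁d : 0 ℕ.< n₁ ℕ.* d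
    0<n₁d = ℕ.>-nonZero⁻¹ (n₁ ℕ.* d) {{ℕ.m*n≢0 n₁ d {{ℕ.>-nonZero 0<n₁}} {{ℕ.>-nonZero 0<d}}}}

  a≡tr : a ≡ t ℕ.* r
  a≡tr = ℕ.*-cancelˡ-≡ a (t ℕ.* r) 2 (trans 2a≡tK (trans (cong (t ℕ.*_) K≡2r) (ℕ-Solver.solve (t ∷ r ∷ []))))

open import Data.Nat using (_∸_; _*_; _+_; _/_; _≤_; _<_; NonZero)

lemma5p2 : ∀ {q : ℕ} (F : FiniteField q) (T : Teichmuller F)
    → ¬ (2 ∣ q)
    → (n : ℕ) .{{_ : NonZero n}} → 2 ≤ n → n ∣ q ∸ 1
    → (n₁ n₂ n₃ : ℕ) → 0 < n₁ → n₁ < n → 0 < n₂ → n₂ < n → 0 < n₃ → n₃ < n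
    → let a₁ = n₁ * ((q ∸ 1) / n)
          a₂ = n₂ * ((q ∸ 1) / n)
          a₃ = n₃ * ((q ∸ 1) / n) in
      a₃ ≡ a₂
    → (q ∸ 1) ∣ 2 * (a₁ + a₂)
    → a₁ + a₂ ≢ q ∸ 1
    → (α : FiniteField.Carrier F) → α ≢ FiniteField.0# F → α ≢ FiniteField.1# F
    → pow (FiniteField._*_ F) (FiniteField.1# F) α ((q ∸ 1) / 2) ≡ FiniteField.-_ F (FiniteField.1# F)
    → (c : Teichmuller.Carrier T) → Teichmuller.Isc₁ T α a₁ a₂ a₃ c → c ≡ Teichmuller.0# T
lemma5p2 {zero}        F T 2∤q = ⊥-elim (2∤q (divides 0 refl))
lemma5p2 {suc zero}    F T _   = ⊥-elim (no-field-with-one-element F)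
lemma5p2 {suc (suc k)} F T 2∤q n _ n∣K n₁ n₂ _ 0<n₁ n₁<n _ n₂<n _ _ a₃≡a₂ (divides t 2a≡tK) a≢K α α≢0 _ α^[K/2]≡-1 c isc₁
  with odd⇒≡2r+1 (suc (suc k)) 2∤q
... | r , q≡2r+1 with ℕ.suc-injective q≡2r+1
... | K≡2r with exponent-sum-odd {t = t} n₁ n₂ ℕ.z<s K≡2r n∣K 0<n₁ n₁<n n₂<n 2a≡tK a≢K
... | s , a≡[2s+1]r =
  c₁≡0 α≢0 r K≡2r αʳ≡-1 a₁ a₂ t s 2a≡tK a≡[2s+1]r c (subst (λ a₃ → Teichmuller.Isc₁ T α a₁ a₂ a₃ c) a₃≡a₂ isc₁)
  where
  open TeichmullerProperties T using (c₁≡0; module 𝔽)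
  a₁ = n₁ * (suc k / n)
  a₂ = n₂ * (suc k / n)

  αʳ≡-1 : α 𝔽.^ r ≡ 𝔽.- 𝔽.1#
  αʳ≡-1 = trans (sym (𝔽.pow≡^ α r))
    (subst (λ e → pow 𝔽._*_ 𝔽.1# α e ≡ 𝔽.- 𝔽.1#) (trans (cong (_/ 2) K≡2r) ([m+m]/2≡m r)) α^[K/2]≡-1)
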